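{- Let $(a,b,c)$ be a primitive Pythagorean triple and let $E$ be the elliptic curve over $\mathbb{Q}$ given by $y^2=x(x-a^2)(x-b^2)$. Then $E(\mathbb{Q})$ has no point of order $8$.
   Context: A primitive Pythagorean triple is a triple $(a,b,c)$ of positive integers with no common divisor satisfying $a^2+b^2=c^2$. $E(\mathbb{Q})$ denotes the group of rational points of $E$ together with the point at infinity $O$. -}

module Defs where

open import Data.Nat as ℕ using (ℕ; zero; suc)
open import Data.Nat.GCD using (gcd)
open import Data.Integer as ℤ using (ℤ; +_)
open import Data.Rational using (ℚ; 0ℚ; _+_; _*_; _-_; -_; _÷_; ≢-nonZero; _/_)
open import Data.Unit using (⊤)
open import Data.Rational.Properties using (_≟_)
open import Data.Product using (_×_; Σ)
open import Relation.Nullary using (yes; no; ¬_)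
open import Relation.Binary.PropositionalEquality using (_≡_; _≢_)

PrimitivePythagoreanTriple : ℕ → ℕ → ℕ → Set
PrimitivePythagoreanTriple a b c =
  (0 ℕ.< a) × (0 ℕ.< b) × (0 ℕ.< c) ×
  (gcd (gcd a b) c ≡ 1) × (a ℕ.* a ℕ.+ b ℕ.* b ≡ c ℕ.* c)

record Curve : Set where
  constructor weierstrass
  field a₂ a₄ a₆ : ℚ

data Point : Set where
  O   : Point
  aff : ℚ → ℚ → Point

OnCurve : Curve → Point → Set
OnCurve E O = ⊤
OnCurve (weierstrass a₂ a₄ a₆) (aff x y) =
  y * y ≡ x * x * x + a₂ * x * x + a₄ * x + a₆

-- Total division (only ever used with nonzero denominator in `add` on curve points).
div : ℚ → ℚ → ℚ
div p q with q ≟ 0ℚ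
... | yes _  = 0ℚ
... | no q≢0 = _÷_ p q {{≢-nonZero q≢0}}

ℚ2 ℚ3 : ℚ
ℚ2 = + 2 / 1
ℚ3 = + 3 / 1

add : Curve → Point → Point → Point
add E O Q = Q
add E P O = P
add (weierstrass a₂ a₄ a₆) (aff x₁ y₁) (aff x₂ y₂) with x₁ ≟ x₂
... | no _ = third ((div (y₂ - y₁) (x₂ - x₁)))
  where
  third : ℚ → Point
  third λ' = let x₃ = λ' * λ' - a₂ - x₁ - x₂ in aff x₃ (- (λ' * (x₃ - x₁) + y₁))
... | yes _ with y₁ ≟ (- y₂)
...   | yes _ = O
...   | no _  = third (div (ℚ3 * x₁ * x₁ + ℚ2 * a₂ * x₁ + a₄) (ℚ2 * y₁))
  where
  third : ℚ → Point
  third λ' = let x₃ = λ' * λ' - a₂ - x₁ - x₂ in aff x₃ (- (λ' * (x₃ - x₁) + y₁))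

smul : Curve → ℕ → Point → Point
smul E zero    P = O
smul E (suc n) P = add E P (smul E n P)

HasOrder : Curve → Point → ℕ → Set
HasOrder E P n = (0 ℕ.< n) × (smul E n P ≡ O) ×
                 ((k : ℕ) → 0 ℕ.< k → k ℕ.< n → smul E k P ≢ O)

-- E_{a,b} : y² = x(x − a²)(x − b²) = x³ − (a²+b²) x² + a²b² x.
E[_,_] : ℕ → ℕ → Curve
E[ a , b ] = weierstrass (- (A + B)) (A * B) 0ℚ
  where
  A B : ℚ
  A = + (a ℕ.* a) / 1
  B = + (b ℕ.* b) / 1

{-# OPTIONS --safe #-}

-- If P has order 8 then 4P = (x₄ , 0) is a point of order 2 in 2 E(ℚ). For
-- each root e of x (x - a²) (x - b²), the map x ↦ x - e is a homomorphism
-- E(ℚ) → ℚ*/ℚ*², so x₄ - e is a square for the two roots e ≠ x₄. Both facts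
-- are derived from two properties of triples with P + Q + R = O (the product
-- of their values x - e is a square, and the relation is symmetric in Q, R),
-- without using associativity of the group law.
-- For x₄ = 0 this makes -a² a square; for x₄ = a² or b² it makes ±(a² - b²)
-- a square, which together with a² + b² = c² contradicts Fermat's theorem that
-- x² - y² and x² + y² are never both squares (proved by infinite descent).

module Submission where

open import Data.Rational using (ℚ)

module RationalField where

  open import Data.Rational using (ℚ; 0ℚ; 1ℚ; _+_; _*_; _-_; -_; 1/_; ≢-nonZero)
  open import Data.Rational.Properties
  open import Data.Empty using (⊥-elim)
  open import Data.Maybe using (Maybe; just; nothing)
  open import Data.Product using (Σ; _,_)
  open import Data.Sum as Sum using (_⊎_; inj₁; inj₂; [_,_]′)
  open import Function using (_∘_; id)
  open import Relation.Nullary using (yes; no)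
  open import Relation.Binary.PropositionalEquality
  open import Tactic.RingSolver using (solve-∀)
  import Tactic.RingSolver.Core.AlmostCommutativeRing as ACR
  open import Algebra.Properties.Group +-0-group using (x∙y⁻¹≈ε⇒x≈y)
  open import Defs using (div)

  ℚ-ring : ACR.AlmostCommutativeRing _ _
  ℚ-ring = ACR.fromCommutativeRing +-*-commutativeRing is-zero
    where
    is-zero : (p : ℚ) → Maybe (0ℚ ≡ p)
    is-zero p with 0ℚ ≟ p
    ... | yes 0≡p = just 0≡p
    ... | no _    = nothing

  IsSquare : ℚ → Set
  IsSquare p = Σ ℚ λ s → p ≡ s * s

  p-q≡0⇒p≡q : ∀ {p q} → p - q ≡ 0ℚ → p ≡ q
  p-q≡0⇒p≡q {p} {q} = x∙y⁻¹≈ε⇒x≈y p q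

  p≡q⇒p-q≡0 : ∀ {p q} → p ≡ q → p - q ≡ 0ℚ
  p≡q⇒p-q≡0 {p} refl = +-inverseʳ p

  p≢q⇒p-q≢0 : ∀ {p q} → p ≢ q → p - q ≢ 0ℚ
  p≢q⇒p-q≢0 p≢q = p≢q ∘ p-q≡0⇒p≡q

  p≢0∧p*q≡0⇒q≡0 : ∀ {p q} → p ≢ 0ℚ → p * q ≡ 0ℚ → q ≡ 0ℚ
  p≢0∧p*q≡0⇒q≡0 {p} {q} p≢0 pq≡0 = begin
    q              ≡⟨ sym (*-identityˡ q) ⟩
    1ℚ * q         ≡⟨ cong (_* q) (sym (*-inverseˡ p)) ⟩
    (1/ p * p) * q ≡⟨ *-assoc (1/ p) p q ⟩
    1/ p * (p * q) ≡⟨ cong (1/ p *_) pq≡0 ⟩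
    1/ p * 0ℚ      ≡⟨ *-zeroʳ (1/ p) ⟩
    0ℚ             ∎
    where open ≡-Reasoning
          instance _ = ≢-nonZero p≢0

  p*q≡0⇒p≡0∨q≡0 : ∀ p q → p * q ≡ 0ℚ → p ≡ 0ℚ ⊎ q ≡ 0ℚ
  p*q≡0⇒p≡0∨q≡0 p q pq≡0 with p ≟ 0ℚ
  ... | yes p≡0 = inj₁ p≡0
  ... | no  p≢0 = inj₂ (p≢0∧p*q≡0⇒q≡0 p≢0 pq≡0)

  p*q≢0 : ∀ {p q} → p ≢ 0ℚ → q ≢ 0ℚ → p * q ≢ 0ℚ
  p*q≢0 {p} {q} p≢0 q≢0 pq≡0 with p*q≡0⇒p≡0∨q≡0 p q pq≡0
  ... | inj₁ p≡0 = p≢0 p≡0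
  ... | inj₂ q≡0 = q≢0 q≡0

  *-cancelʳ-≡ : ∀ p q r → r ≢ 0ℚ → p * r ≡ q * r → p ≡ q
  *-cancelʳ-≡ p q r r≢0 pr≡qr = p-q≡0⇒p≡q (p≢0∧p*q≡0⇒q≡0 r≢0 (begin
    r * (p - q)   ≡⟨ distrib p q r ⟩
    p * r - q * r ≡⟨ p≡q⇒p-q≡0 pr≡qr ⟩
    0ℚ            ∎))
    where open ≡-Reasoning
          distrib : ∀ p q r → r * (p - q) ≡ p * r - q * r
          distrib = solve-∀ ℚ-ring

  div-*-cancel : ∀ p q → q ≢ 0ℚ → div p q * q ≡ p
  div-*-cancel p q q≢0 with q ≟ 0ℚ
  ... | yes q≡0 = ⊥-elim (q≢0 q≡0)
  ... | no q≢0′ = begin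
    p * 1/ q * q   ≡⟨ *-assoc p (1/ q) q ⟩
    p * (1/ q * q) ≡⟨ cong (p *_) (*-inverseˡ q) ⟩
    p * 1ℚ         ≡⟨ *-identityʳ p ⟩
    p              ∎
    where open ≡-Reasoning
          instance _ = ≢-nonZero q≢0′

  p*p≡q*q⇒p≡q∨p≡-q : ∀ p q → p * p ≡ q * q → p ≡ q ⊎ p ≡ - q
  p*p≡q*q⇒p≡q∨p≡-q p q pp≡qq =
    Sum.map p-q≡0⇒p≡q (p-q≡0⇒p≡q ∘ trans (minus-neg p q))
      (p*q≡0⇒p≡0∨q≡0 (p - q) (p + q) (trans (difference-of-squares p q) (p≡q⇒p-q≡0 pp≡qq)))
    where
    difference-of-squares : ∀ p q → (p - q) * (p + q) ≡ p * p - q * q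
    difference-of-squares = solve-∀ ℚ-ring
    minus-neg : ∀ p q → p - - q ≡ p + q
    minus-neg = solve-∀ ℚ-ring

  p*p≡0⇒p≡0 : ∀ {p} → p * p ≡ 0ℚ → p ≡ 0ℚ
  p*p≡0⇒p≡0 {p} pp≡0 = [ id , id ]′ (p*q≡0⇒p≡0∨q≡0 p p pp≡0)

  p≡-p⇒p≡0 : ∀ {p} → p ≡ - p → p ≡ 0ℚ
  p≡-p⇒p≡0 {p} p≡-p = p≢0∧p*q≡0⇒q≡0 {1ℚ + 1ℚ} (λ ()) (begin
    (1ℚ + 1ℚ) * p ≡⟨ double p ⟩
    p - - p       ≡⟨ p≡q⇒p-q≡0 p≡-p ⟩
    0ℚ            ∎)
    where open ≡-Reasoning
          double : ∀ p → (1ℚ + 1ℚ) * p ≡ p - - p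
          double = solve-∀ ℚ-ring

  square-cancelʳ : ∀ p q → IsSquare (p * q) → IsSquare q → q ≢ 0ℚ → IsSquare p
  square-cancelʳ p q (s , pq≡ss) (t , q≡tt) q≢0 = r , *-cancelʳ-≡ p (r * r) q q≢0 (begin
    p * q             ≡⟨ pq≡ss ⟩
    s * s             ≡⟨ cong (λ u → u * u) (sym rt≡s) ⟩
    (r * t) * (r * t) ≡⟨ regroup r t ⟩
    (r * r) * (t * t) ≡⟨ cong ((r * r) *_) (sym q≡tt) ⟩
    (r * r) * q       ∎)
    where
    open ≡-Reasoning
    t≢0 : t ≢ 0ℚ
    t≢0 t≡0 = q≢0 (trans q≡tt (cong (λ u → u * u) t≡0))
    r : ℚ
    r = div s t
    rt≡s : r * t ≡ s
    rt≡s = div-*-cancel s t t≢0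
    regroup : ∀ r t → (r * t) * (r * t) ≡ (r * r) * (t * t)
    regroup = solve-∀ ℚ-ring

module Weierstrass (α β γ : ℚ) where

  open import Data.Nat as ℕ using (ℕ; zero; suc; s≤s; z≤n)
  open import Data.Nat.Properties using (+-suc)
  open import Data.Rational using (0ℚ; 1ℚ; _+_; _*_; _-_; -_)
  open import Data.Rational.Properties using (_≟_)
  open import Data.Empty using (⊥; ⊥-elim)
  open import Data.Product using (Σ; _×_; _,_; proj₁; proj₂)
  open import Data.Sum using ([_,_]′)
  open import Function using (_∘_; id)
  open import Relation.Nullary using (Dec; yes; no)
  open import Relation.Binary.PropositionalEquality
  open import Tactic.RingSolver using (solve-∀)
  open import Defs using (Curve; weierstrass; Point; O; aff; OnCurve; add; smul; HasOrder; div; ℚ2)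
  open RationalField

  E : Curve
  E = weierstrass α β γ

  cubic cubic′ : ℚ → ℚ
  cubic  t = t * t * t + α * t * t + β * t + γ
  cubic′ t = (1ℚ + 1ℚ + 1ℚ) * t * t + (1ℚ + 1ℚ) * α * t + β

  residue : ℚ → ℚ → ℚ → ℚ
  residue l m t = cubic t - (l * t + m) * (l * t + m)

  -- The roots of the monic cubic residue l m sum to l² - α.
  thirdX : ℚ → ℚ → ℚ → ℚ
  thirdX l x₁ x₂ = l * l - α - x₁ - x₂

  Factors : ℚ → ℚ → ℚ → ℚ → ℚ → Set
  Factors l m x₁ x₂ x₃ = ∀ t → residue l m t ≡ (t - x₁) * (t - x₂) * (t - x₃)

  Tangent : ℚ → ℚ → ℚ → Set
  Tangent l m x = cubic′ x ≡ (1ℚ + 1ℚ) * l * (l * x + m)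

  NonSingular : Set
  NonSingular = ∀ x → cubic x ≡ 0ℚ → cubic′ x ≢ 0ℚ

  neg : Point → Point
  neg O         = O
  neg (aff x y) = aff x (- y)

  neg-involutive : ∀ R → neg (neg R) ≡ R
  neg-involutive O         = refl
  neg-involutive (aff x y) = cong (aff x) (neg-neg y)
    where neg-neg : ∀ y → - - y ≡ y
          neg-neg = solve-∀ ℚ-ring

  add-chord : ∀ x₁ y₁ x₂ y₂ → x₁ ≢ x₂ →
    let l = div (y₂ - y₁) (x₂ - x₁) in
    add E (aff x₁ y₁) (aff x₂ y₂) ≡ aff (thirdX l x₁ x₂) (- (l * (thirdX l x₁ x₂ - x₁) + y₁))
  add-chord x₁ y₁ x₂ y₂ x₁≢x₂ with x₁ ≟ x₂
  ... | yes x₁≡x₂ = ⊥-elim (x₁≢x₂ x₁≡x₂)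
  ... | no _      = refl

  add-vertical : ∀ x₁ y₁ x₂ y₂ → x₁ ≡ x₂ → y₁ ≡ - y₂ → add E (aff x₁ y₁) (aff x₂ y₂) ≡ O
  add-vertical x₁ y₁ x₂ y₂ x₁≡x₂ y₁≡-y₂ with x₁ ≟ x₂
  ... | no x₁≢x₂ = ⊥-elim (x₁≢x₂ x₁≡x₂)
  ... | yes _ with y₁ ≟ - y₂
  ...   | yes _     = refl
  ...   | no y₁≢-y₂ = ⊥-elim (y₁≢-y₂ y₁≡-y₂)

  add-tangent : ∀ x₁ y₁ x₂ y₂ → x₁ ≡ x₂ → y₁ ≢ - y₂ →
    let l = div (cubic′ x₁) (ℚ2 * y₁) in
    add E (aff x₁ y₁) (aff x₂ y₂) ≡ aff (thirdX l x₁ x₂) (- (l * (thirdX l x₁ x₂ - x₁) + y₁))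
  add-tangent x₁ y₁ x₂ y₂ x₁≡x₂ y₁≢-y₂ with x₁ ≟ x₂
  ... | no x₁≢x₂ = ⊥-elim (x₁≢x₂ x₁≡x₂)
  ... | yes _ with y₁ ≟ - y₂
  ...   | yes y₁≡-y₂ = ⊥-elim (y₁≢-y₂ y₁≡-y₂)
  ...   | no _       = refl

  residue-root : ∀ l m x y → OnCurve E (aff x y) → l * x + m ≡ y → residue l m x ≡ 0ℚ
  residue-root l m x y on through = p≡q⇒p-q≡0 (begin
    cubic x                   ≡⟨ sym on ⟩
    y * y                     ≡⟨ cong (λ u → u * u) (sym through) ⟩
    (l * x + m) * (l * x + m) ∎)
    where open ≡-Reasoning

  chord-factorisation : ∀ {l m x₁ x₂} → x₁ ≢ x₂ → residue l m x₁ ≡ 0ℚ → residue l m x₂ ≡ 0ℚ →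
    Factors l m x₁ x₂ (thirdX l x₁ x₂)
  chord-factorisation {l} {m} {x₁} {x₂} x₁≢x₂ r₁≡0 r₂≡0 t =
    p-q≡0⇒p≡q (*-cancelʳ-≡ _ 0ℚ (x₂ - x₁) (p≢q⇒p-q≢0 (x₁≢x₂ ∘ sym)) (begin
      (residue l m t - P) * (x₂ - x₁)                        ≡⟨ interpolation α β γ l m x₁ x₂ t ⟩
      residue l m x₁ * (x₂ - t) + residue l m x₂ * (t - x₁)
        ≡⟨ cong₂ (λ u v → u * (x₂ - t) + v * (t - x₁)) r₁≡0 r₂≡0 ⟩
      0ℚ * (x₂ - t) + 0ℚ * (t - x₁)                          ≡⟨ zeros (x₂ - t) (t - x₁) (x₂ - x₁) ⟩
      0ℚ * (x₂ - x₁)                                         ∎))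
    where
    open ≡-Reasoning
    P = (t - x₁) * (t - x₂) * (t - thirdX l x₁ x₂)
    interpolation : ∀ α β γ l m x₁ x₂ t →
      ((t * t * t + α * t * t + β * t + γ - (l * t + m) * (l * t + m))
        - (t - x₁) * (t - x₂) * (t - (l * l - α - x₁ - x₂))) * (x₂ - x₁)
      ≡ (x₁ * x₁ * x₁ + α * x₁ * x₁ + β * x₁ + γ - (l * x₁ + m) * (l * x₁ + m)) * (x₂ - t)
        + (x₂ * x₂ * x₂ + α * x₂ * x₂ + β * x₂ + γ - (l * x₂ + m) * (l * x₂ + m)) * (t - x₁)
    interpolation = solve-∀ ℚ-ring
    zeros : ∀ a b c → 0ℚ * a + 0ℚ * b ≡ 0ℚ * c
    zeros = solve-∀ ℚ-ring

  -- First-order Taylor expansion of residue l m at x₁.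
  residue-expansion : ∀ l m x₁ t →
    residue l m t - (t - x₁) * (t - x₁) * (t - thirdX l x₁ x₁)
    ≡ residue l m x₁ + (t - x₁) * (cubic′ x₁ - (1ℚ + 1ℚ) * l * (l * x₁ + m))
  residue-expansion = expansion α β γ
    where
    expansion : ∀ α β γ l m x₁ t →
      (t * t * t + α * t * t + β * t + γ - (l * t + m) * (l * t + m))
        - (t - x₁) * (t - x₁) * (t - (l * l - α - x₁ - x₁))
      ≡ (x₁ * x₁ * x₁ + α * x₁ * x₁ + β * x₁ + γ - (l * x₁ + m) * (l * x₁ + m))
        + (t - x₁) * (((1ℚ + 1ℚ + 1ℚ) * x₁ * x₁ + (1ℚ + 1ℚ) * α * x₁ + β) - (1ℚ + 1ℚ) * l * (l * x₁ + m))
    expansion = solve-∀ ℚ-ring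

  tangent-factorisation : ∀ {l m x₁} → residue l m x₁ ≡ 0ℚ → Tangent l m x₁ →
    Factors l m x₁ x₁ (thirdX l x₁ x₁)
  tangent-factorisation {l} {m} {x₁} r≡0 tangent t = p-q≡0⇒p≡q (begin
    residue l m t - (t - x₁) * (t - x₁) * (t - thirdX l x₁ x₁) ≡⟨ residue-expansion l m x₁ t ⟩
    residue l m x₁ + (t - x₁) * (cubic′ x₁ - (1ℚ + 1ℚ) * l * (l * x₁ + m))
      ≡⟨ cong₂ (λ u v → u + (t - x₁) * v) r≡0 (p≡q⇒p-q≡0 tangent) ⟩
    0ℚ + (t - x₁) * 0ℚ ≡⟨ zeros (t - x₁) ⟩
    0ℚ                 ∎)
    where
    open ≡-Reasoning
    zeros : ∀ a → 0ℚ + a * 0ℚ ≡ 0ℚ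
    zeros = solve-∀ ℚ-ring

  double-root⇒tangent : ∀ l m x₁ →
    Factors l m x₁ x₁ (thirdX l x₁ x₁) → Tangent l m x₁
  double-root⇒tangent l m x₁ factorisation = p-q≡0⇒p≡q (begin
    D                                                  ≡⟨ unit-step x₁ D ⟩
    0ℚ + ((x₁ + 1ℚ) - x₁) * D                          ≡⟨ cong (λ u → u + ((x₁ + 1ℚ) - x₁) * D) (sym r≡0) ⟩
    residue l m x₁ + ((x₁ + 1ℚ) - x₁) * D              ≡⟨ sym (residue-expansion l m x₁ (x₁ + 1ℚ)) ⟩
    residue l m (x₁ + 1ℚ) - P                          ≡⟨ p≡q⇒p-q≡0 (factorisation (x₁ + 1ℚ)) ⟩
    0ℚ                                                 ∎)
    where
    open ≡-Reasoning
    D = cubic′ x₁ - (1ℚ + 1ℚ) * l * (l * x₁ + m)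
    P = ((x₁ + 1ℚ) - x₁) * ((x₁ + 1ℚ) - x₁) * ((x₁ + 1ℚ) - thirdX l x₁ x₁)
    unit-step : ∀ x d → d ≡ 0ℚ + ((x + 1ℚ) - x) * d
    unit-step = solve-∀ ℚ-ring
    vanishes : ∀ a b → (a - a) * (a - a) * b ≡ 0ℚ
    vanishes = solve-∀ ℚ-ring
    r≡0 : residue l m x₁ ≡ 0ℚ
    r≡0 = trans (factorisation x₁) (vanishes x₁ _)

  record Chord (x₁ y₁ x₂ y₂ : ℚ) : Set where
    field
      slope intercept : ℚ
      through₁      : slope * x₁ + intercept ≡ y₁
      through₂      : slope * x₂ + intercept ≡ y₂
      factorisation : Factors slope intercept x₁ x₂ (thirdX slope x₁ x₂)
      sum           : add E (aff x₁ y₁) (aff x₂ y₂)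
                      ≡ aff (thirdX slope x₁ x₂) (- (slope * thirdX slope x₁ x₂ + intercept))

    third third-y : ℚ
    third   = thirdX slope x₁ x₂
    third-y = slope * third + intercept

  data Addition (x₁ y₁ x₂ y₂ : ℚ) : Set where
    vertical : x₁ ≡ x₂ → y₁ ≡ - y₂ → add E (aff x₁ y₁) (aff x₂ y₂) ≡ O → Addition x₁ y₁ x₂ y₂
    chord    : Chord x₁ y₁ x₂ y₂ → Addition x₁ y₁ x₂ y₂

  private
    through-base : ∀ l x y → l * x + (y - l * x) ≡ y
    through-base = solve-∀ ℚ-ring
    sum-shape : ∀ l X x₁ y₁ → l * (X - x₁) + y₁ ≡ l * X + (y₁ - l * x₁)
    sum-shape = solve-∀ ℚ-ring

  secant-chord : ∀ {x₁ y₁ x₂ y₂} → OnCurve E (aff x₁ y₁) → OnCurve E (aff x₂ y₂) → x₁ ≢ x₂ →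
    Chord x₁ y₁ x₂ y₂
  secant-chord {x₁} {y₁} {x₂} {y₂} on₁ on₂ x₁≢x₂ = record
    { slope         = l
    ; intercept     = y₁ - l * x₁
    ; through₁      = through-base l x₁ y₁
    ; through₂      = through₂
    ; factorisation = chord-factorisation {l} {y₁ - l * x₁} x₁≢x₂
                        (residue-root l (y₁ - l * x₁) x₁ y₁ on₁ (through-base l x₁ y₁))
                        (residue-root l (y₁ - l * x₁) x₂ y₂ on₂ through₂)
    ; sum           = trans (add-chord x₁ y₁ x₂ y₂ x₁≢x₂)
                        (cong (aff (thirdX l x₁ x₂) ∘ -_) (sum-shape l (thirdX l x₁ x₂) x₁ y₁))
    }
    where
    open ≡-Reasoning
    l = div (y₂ - y₁) (x₂ - x₁)
    through₂ : l * x₂ + (y₁ - l * x₁) ≡ y₂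
    through₂ = begin
      l * x₂ + (y₁ - l * x₁) ≡⟨ shift l x₁ x₂ y₁ ⟩
      l * (x₂ - x₁) + y₁
        ≡⟨ cong (_+ y₁) (div-*-cancel (y₂ - y₁) (x₂ - x₁) (p≢q⇒p-q≢0 (x₁≢x₂ ∘ sym))) ⟩
      (y₂ - y₁) + y₁         ≡⟨ cancel y₁ y₂ ⟩
      y₂                     ∎
      where
      shift : ∀ l x₁ x₂ y₁ → l * x₂ + (y₁ - l * x₁) ≡ l * (x₂ - x₁) + y₁
      shift = solve-∀ ℚ-ring
      cancel : ∀ y₁ y₂ → (y₂ - y₁) + y₁ ≡ y₂
      cancel = solve-∀ ℚ-ring

  tangent-chord : ∀ {x₁ y₁ y₂} → OnCurve E (aff x₁ y₁) → OnCurve E (aff x₁ y₂) → y₁ ≢ - y₂ →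
    Chord x₁ y₁ x₁ y₂
  tangent-chord {x₁} {y₁} {y₂} on₁ on₂ y₁≢-y₂ = record
    { slope         = l
    ; intercept     = y₁ - l * x₁
    ; through₁      = through-base l x₁ y₁
    ; through₂      = trans (through-base l x₁ y₁) y₁≡y₂
    ; factorisation = tangent-factorisation {l} {y₁ - l * x₁}
                        (residue-root l (y₁ - l * x₁) x₁ y₁ on₁ (through-base l x₁ y₁)) touches
    ; sum           = trans (add-tangent x₁ y₁ x₁ y₂ refl y₁≢-y₂)
                        (cong (aff (thirdX l x₁ x₁) ∘ -_) (sum-shape l (thirdX l x₁ x₁) x₁ y₁))
    }
    where
    open ≡-Reasoning
    y₁≡y₂ : y₁ ≡ y₂
    y₁≡y₂ = [ id , ⊥-elim ∘ y₁≢-y₂ ]′ (p*p≡q*q⇒p≡q∨p≡-q y₁ y₂ (trans on₁ (sym on₂)))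
    2y₁≢0 : ℚ2 * y₁ ≢ 0ℚ
    2y₁≢0 2y₁≡0 = y₁≢-y₂ (trans y₁≡0 (sym (trans (cong -_ (sym y₁≡y₂)) (cong -_ y₁≡0))))
      where y₁≡0 = p≢0∧p*q≡0⇒q≡0 {ℚ2} {y₁} (λ ()) 2y₁≡0
    l = div (cubic′ x₁) (ℚ2 * y₁)
    touches : Tangent l (y₁ - l * x₁) x₁
    touches = begin
      cubic′ x₁                              ≡⟨ sym (div-*-cancel (cubic′ x₁) (ℚ2 * y₁) 2y₁≢0) ⟩
      l * (ℚ2 * y₁)                          ≡⟨ reassoc l y₁ ⟩
      (1ℚ + 1ℚ) * l * y₁                     ≡⟨ cong ((1ℚ + 1ℚ) * l *_) (sym (through-base l x₁ y₁)) ⟩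
      (1ℚ + 1ℚ) * l * (l * x₁ + (y₁ - l * x₁)) ∎
      where reassoc : ∀ l y → l * ((1ℚ + 1ℚ) * y) ≡ (1ℚ + 1ℚ) * l * y
            reassoc = solve-∀ ℚ-ring

  addition : ∀ {x₁ y₁ x₂ y₂} → OnCurve E (aff x₁ y₁) → OnCurve E (aff x₂ y₂) → Addition x₁ y₁ x₂ y₂
  addition {x₁} {y₁} {x₂} {y₂} on₁ on₂ with x₁ ≟ x₂
  ... | no x₁≢x₂ = chord (secant-chord on₁ on₂ x₁≢x₂)
  ... | yes refl with y₁ ≟ - y₂
  ...   | yes y₁≡-y₂ = vertical refl y₁≡-y₂ (add-vertical x₁ y₁ x₁ y₂ refl y₁≡-y₂)
  ...   | no y₁≢-y₂  = chord (tangent-chord on₁ on₂ y₁≢-y₂)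

  neg-flip : ∀ {A B} → A ≡ neg B → neg A ≡ B
  neg-flip {B = B} A≡-B = trans (cong neg A≡-B) (neg-involutive B)

  neg≡O⇒≡O : ∀ R → neg R ≡ O → R ≡ O
  neg≡O⇒≡O O         _ = refl
  neg≡O⇒≡O (aff x y) ()

  chord-third-on-curve : ∀ {x₁ y₁ x₂ y₂} (L : Chord x₁ y₁ x₂ y₂) → let open Chord L in
    OnCurve E (aff third third-y)
  chord-third-on-curve {x₁} {x₂ = x₂} L = sym (p-q≡0⇒p≡q (trans (factorisation third) (vanishes x₁ x₂ third)))
    where
    open Chord L
    vanishes : ∀ a b c → (c - a) * (c - b) * (c - c) ≡ 0ℚ
    vanishes = solve-∀ ℚ-ring

  neg-on-curve : ∀ x y → OnCurve E (aff x y) → OnCurve E (aff x (- y))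
  neg-on-curve x y on = trans (neg-square y) on
    where neg-square : ∀ y → (- y) * (- y) ≡ y * y
          neg-square = solve-∀ ℚ-ring

  add-closed : ∀ P Q → OnCurve E P → OnCurve E Q → OnCurve E (add E P Q)
  add-closed O         Q         _   on-Q = on-Q
  add-closed (aff x y) O         on-P _   = on-P
  add-closed (aff x₁ y₁) (aff x₂ y₂) on₁ on₂ = closed (addition on₁ on₂)
    where
    closed : Addition x₁ y₁ x₂ y₂ → OnCurve E (add E (aff x₁ y₁) (aff x₂ y₂))
    closed (vertical _ _ sum≡O) = subst (OnCurve E) (sym sum≡O) _
    closed (chord L)            =
      subst (OnCurve E) (sym (Chord.sum L)) (neg-on-curve (Chord.third L) (Chord.third-y L) (chord-third-on-curve L))

  smul-closed : ∀ n P → OnCurve E P → OnCurve E (smul E n P)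
  smul-closed zero    P _    = _
  smul-closed (suc n) P on-P = add-closed P (smul E n P) on-P (smul-closed n P on-P)

  thirdX-involutive : ∀ l x₁ x₂ → thirdX l x₁ (thirdX l x₁ x₂) ≡ x₂
  thirdX-involutive = involution α
    where involution : ∀ α l x₁ x₂ → l * l - α - x₁ - (l * l - α - x₁ - x₂) ≡ x₂
          involution = solve-∀ ℚ-ring

  chord-tangent-at-third : ∀ {x₁ y₁ x₂ y₂} (L : Chord x₁ y₁ x₂ y₂) → let open Chord L in
    third ≡ x₁ → Tangent slope intercept x₁
  chord-tangent-at-third {x₁} {y₁} {x₂} {y₂} L third≡x₁ = double-root⇒tangent slope intercept x₁ λ t → begin
    residue slope intercept t                            ≡⟨ factorisation t ⟩
    (t - x₁) * (t - x₂) * (t - third)                    ≡⟨ swap₂₃ t x₁ x₂ third ⟩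
    (t - x₁) * (t - third) * (t - x₂)
      ≡⟨ cong₂ (λ u v → (t - x₁) * (t - u) * (t - v)) third≡x₁ x₂≡ ⟩
    (t - x₁) * (t - x₁) * (t - thirdX slope x₁ x₁)       ∎
    where
    open ≡-Reasoning
    open Chord L
    swap₂₃ : ∀ t a b c → (t - a) * (t - b) * (t - c) ≡ (t - a) * (t - c) * (t - b)
    swap₂₃ = solve-∀ ℚ-ring
    x₂≡ : x₂ ≡ thirdX slope x₁ x₁
    x₂≡ = trans (sym (thirdX-involutive slope x₁ x₂)) (cong (thirdX slope x₁) third≡x₁)

  chord-tangent-at-double : ∀ {x₁ y₁ x₂ y₂} (L : Chord x₁ y₁ x₂ y₂) → let open Chord L in
    x₂ ≡ x₁ → Tangent slope intercept x₁
  chord-tangent-at-double {x₁} L refl = double-root⇒tangent (Chord.slope L) (Chord.intercept L) x₁ (Chord.factorisation L)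

  tangent-point-ordinate≢0 : NonSingular → ∀ {l m x y} → OnCurve E (aff x y) → l * x + m ≡ y →
    Tangent l m x → y ≢ 0ℚ
  tangent-point-ordinate≢0 ns {l} {m} {x} {y} on through touches y≡0 = ns x cubic≡0 (begin
    cubic′ x                        ≡⟨ touches ⟩
    (1ℚ + 1ℚ) * l * (l * x + m)     ≡⟨ cong ((1ℚ + 1ℚ) * l *_) (trans through y≡0) ⟩
    (1ℚ + 1ℚ) * l * 0ℚ              ≡⟨ annihilate l ⟩
    0ℚ                              ∎)
    where
    open ≡-Reasoning
    annihilate : ∀ l → (1ℚ + 1ℚ) * l * 0ℚ ≡ 0ℚ
    annihilate = solve-∀ ℚ-ring
    cubic≡0 : cubic x ≡ 0ℚ
    cubic≡0 = trans (sym on) (cong (λ u → u * u) y≡0)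

  tangent-slope-unique : NonSingular → ∀ {l m l′ m′ x y} → OnCurve E (aff x y) →
    l * x + m ≡ y → l′ * x + m′ ≡ y → Tangent l m x → Tangent l′ m′ x → l ≡ l′
  tangent-slope-unique ns {l} {m} {l′} {m′} {x} {y} on through through′ touches touches′ =
    *-cancelʳ-≡ l l′ ((1ℚ + 1ℚ) * y) 2y≢0 (begin
      l * ((1ℚ + 1ℚ) * y)      ≡⟨ reassoc l y ⟩
      (1ℚ + 1ℚ) * l * y        ≡⟨ cong ((1ℚ + 1ℚ) * l *_) (sym through) ⟩
      (1ℚ + 1ℚ) * l * (l * x + m)     ≡⟨ sym touches ⟩
      cubic′ x                        ≡⟨ touches′ ⟩
      (1ℚ + 1ℚ) * l′ * (l′ * x + m′)  ≡⟨ cong ((1ℚ + 1ℚ) * l′ *_) through′ ⟩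
      (1ℚ + 1ℚ) * l′ * y       ≡⟨ sym (reassoc l′ y) ⟩
      l′ * ((1ℚ + 1ℚ) * y)     ∎)
    where
    open ≡-Reasoning
    reassoc : ∀ l y → l * ((1ℚ + 1ℚ) * y) ≡ (1ℚ + 1ℚ) * l * y
    reassoc = solve-∀ ℚ-ring
    2y≢0 : (1ℚ + 1ℚ) * y ≢ 0ℚ
    2y≢0 = tangent-point-ordinate≢0 ns {l} {m} {x} {y} on through touches ∘ p≢0∧p*q≡0⇒q≡0 {1ℚ + 1ℚ} {y} (λ ())

  secant-slope-unique : ∀ {l m l′ m′ x₁ y₁ x₂ y₂} → x₁ ≢ x₂ →
    l * x₁ + m ≡ y₁ → l * x₂ + m ≡ y₂ → l′ * x₁ + m′ ≡ y₁ → l′ * x₂ + m′ ≡ y₂ → l ≡ l′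
  secant-slope-unique {l} {m} {l′} {m′} {x₁} {y₁} {x₂} {y₂} x₁≢x₂ through₁ through₂ through₁′ through₂′ =
    *-cancelʳ-≡ l l′ (x₂ - x₁) (p≢q⇒p-q≢0 (x₁≢x₂ ∘ sym)) (begin
      l * (x₂ - x₁)                       ≡⟨ rise l m x₁ x₂ ⟩
      (l * x₂ + m) - (l * x₁ + m)
        ≡⟨ cong₂ _-_ (trans through₂ (sym through₂′)) (trans through₁ (sym through₁′)) ⟩
      (l′ * x₂ + m′) - (l′ * x₁ + m′)     ≡⟨ sym (rise l′ m′ x₁ x₂) ⟩
      l′ * (x₂ - x₁)                      ∎)
    where
    open ≡-Reasoning
    rise : ∀ l m x₁ x₂ → l * (x₂ - x₁) ≡ (l * x₂ + m) - (l * x₁ + m)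
    rise = solve-∀ ℚ-ring

  intercept-unique : ∀ {l m m′ x y} → l * x + m ≡ y → l * x + m′ ≡ y → m ≡ m′
  intercept-unique {l} {m} {m′} {x} through through′ =
    trans (recover l x m) (trans (cong (_- l * x) (trans through (sym through′))) (sym (recover l x m′)))
    where recover : ∀ l x m → m ≡ (l * x + m) - l * x
          recover = solve-∀ ℚ-ring

  chord-reflection : NonSingular → ∀ {x₁ y₁ x₂ y₂} → OnCurve E (aff x₁ y₁) → (L : Chord x₁ y₁ x₂ y₂) →
    let open Chord L in add E (aff x₁ y₁) (aff third third-y) ≡ aff x₂ (- y₂)
  chord-reflection ns {x₁} {y₁} {x₂} {y₂} on₁ L = reflect (addition on₁ (chord-third-on-curve L))
    where
    open Chord L
    reflect : Addition x₁ y₁ third third-y → add E (aff x₁ y₁) (aff third third-y) ≡ aff x₂ (- y₂)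
    reflect (vertical x₁≡third y₁≡-third-y _) =
      ⊥-elim (tangent-point-ordinate≢0 ns {slope} {intercept} {x₁} {y₁} on₁ through₁
                (chord-tangent-at-third L (sym x₁≡third)) y₁≡0)
      where
      y₁≡0 : y₁ ≡ 0ℚ
      y₁≡0 = p≡-p⇒p≡0 (trans y₁≡-third-y
               (cong -_ (trans (cong (λ x → slope * x + intercept) (sym x₁≡third)) through₁)))
    reflect (chord L′) = trans (Chord.sum L′) (cong₂ aff third′≡x₂ (cong -_ third-y′≡y₂))
      where
      module L′ = Chord L′
      same-slope : Dec (x₁ ≡ third) → L′.slope ≡ slope
      same-slope (no x₁≢third) =
        secant-slope-unique x₁≢third L′.through₁ L′.through₂ through₁ refl
      same-slope (yes x₁≡third) =
        tangent-slope-unique ns {L′.slope} {L′.intercept} {slope} {intercept} on₁ L′.through₁ through₁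
          (chord-tangent-at-double L′ (sym x₁≡third)) (chord-tangent-at-third L (sym x₁≡third))
      slope≡ : L′.slope ≡ slope
      slope≡ = same-slope (x₁ ≟ third)
      intercept≡ : L′.intercept ≡ intercept
      intercept≡ = intercept-unique {slope} {L′.intercept} {intercept} {x₁}
        (subst (λ l → l * x₁ + L′.intercept ≡ y₁) slope≡ L′.through₁) through₁
      third′≡x₂ : L′.third ≡ x₂
      third′≡x₂ = trans (cong (λ l → thirdX l x₁ third) slope≡) (thirdX-involutive slope x₁ x₂)
      third-y′≡y₂ : L′.third-y ≡ y₂
      third-y′≡y₂ = trans (cong₂ (λ l x → l * x + L′.intercept) slope≡ third′≡x₂)
                          (trans (cong (slope * x₂ +_) intercept≡) through₂)

  Collinear : Point → Point → Point → Set
  Collinear P Q R = add E P Q ≡ neg R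

  collinear-swap : NonSingular → ∀ P Q R → OnCurve E P → OnCurve E Q → Collinear P Q R → Collinear P R Q
  collinear-swap ns O Q R _ _ Q≡-R = sym (neg-flip Q≡-R)
  collinear-swap ns (aff x y) O R _ _ P≡-R = begin
    add E (aff x y) R            ≡⟨ cong (add E (aff x y)) (sym (neg-flip P≡-R)) ⟩
    add E (aff x y) (aff x (- y)) ≡⟨ add-vertical x y x (- y) refl (neg-neg y) ⟩
    O                            ∎
    where
    open ≡-Reasoning
    neg-neg : ∀ y → y ≡ - - y
    neg-neg = solve-∀ ℚ-ring
  collinear-swap ns (aff x₁ y₁) (aff x₂ y₂) R on₁ on₂ sum≡-R = swap (addition on₁ on₂)
    where
    swap : Addition x₁ y₁ x₂ y₂ → add E (aff x₁ y₁) R ≡ aff x₂ (- y₂)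
    swap (vertical x₁≡x₂ y₁≡-y₂ sum≡O) =
      trans (cong (add E (aff x₁ y₁)) (neg≡O⇒≡O R (trans (sym sum≡-R) sum≡O))) (cong₂ aff x₁≡x₂ y₁≡-y₂)
    swap (chord L) = subst (λ S → add E (aff x₁ y₁) S ≡ aff x₂ (- y₂)) R≡third (chord-reflection ns on₁ L)
      where
      open Chord L
      R≡third : aff third third-y ≡ R
      R≡third = trans (sym (neg-involutive (aff third third-y))) (neg-flip (trans (sym sum) sum≡-R))

  smul-complement : NonSingular → ∀ {n} P → OnCurve E P → smul E n P ≡ O →
    ∀ k m → k ℕ.+ m ≡ n → smul E k P ≡ neg (smul E m P)
  smul-complement ns {n} P on nP≡O zero m m≡n =
    sym (cong neg (trans (cong (λ j → smul E j P) m≡n) nP≡O))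
  smul-complement ns {n} P on nP≡O (suc k) m 1+k+m≡n =
    collinear-swap ns P (smul E m P) (smul E k P) on (smul-closed m P on)
      (sym (neg-flip (smul-complement ns P on nP≡O k (suc m) (trans (+-suc k m) 1+k+m≡n))))

  module DescentMap (e : ℚ) (root : cubic e ≡ 0ℚ) (simple : cubic′ e ≢ 0ℚ) where

    -- x ↦ x - e, the component at e of the 2-descent map E(ℚ) → ℚ*/ℚ*², with
    -- the usual value cubic′ e at the 2-torsion point (e , 0) and 1 at O.
    κ : ℚ → ℚ
    κ x with x ≟ e
    ... | yes _ = cubic′ e
    ... | no _  = x - e

    κ-at-root : ∀ {x} → x ≡ e → κ x ≡ cubic′ e
    κ-at-root {x} x≡e with x ≟ e
    ... | yes _   = refl
    ... | no x≢e = ⊥-elim (x≢e x≡e)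

    κ-off-root : ∀ {x} → x ≢ e → κ x ≡ x - e
    κ-off-root {x} x≢e with x ≟ e
    ... | yes x≡e = ⊥-elim (x≢e x≡e)
    ... | no _    = refl

    κ≢0 : ∀ x → κ x ≢ 0ℚ
    κ≢0 x with x ≟ e
    ... | yes _   = simple
    ... | no x≢e = p≢q⇒p-q≢0 x≢e

    κₚ : Point → ℚ
    κₚ O         = 1ℚ
    κₚ (aff x _) = κ x

    κₚ≢0 : ∀ P → κₚ P ≢ 0ℚ
    κₚ≢0 O         ()
    κₚ≢0 (aff x _) = κ≢0 x

    κₚ-neg : ∀ P → κₚ (neg P) ≡ κₚ P
    κₚ-neg O         = refl
    κₚ-neg (aff _ _) = refl

    -- Dividing the factorisation by t - e leaves a polynomial q of degree at
    -- most one vanishing at e + 1 and e + 2, hence at e; its value there is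
    -- cubic′ e - (e - u) (e - v).
    cubic′-at-root : ∀ l m u v → Factors l m e u v → cubic′ e ≡ (e - u) * (e - v)
    cubic′-at-root l m u v factors = p-q≡0⇒p≡q (trans (sym (q-at-e α β l e u v)) q[e]≡0)
      where
      open ≡-Reasoning
      c = l * e + m
      c≡0 : c ≡ 0ℚ
      c≡0 = p*p≡0⇒p≡0 (trans (sym (p-q≡0⇒p≡q (trans (factors e) (vanishes e u v)))) root)
        where vanishes : ∀ e u v → (e - e) * (e - u) * (e - v) ≡ 0ℚ
              vanishes = solve-∀ ℚ-ring
      q : ℚ → ℚ
      q t = (t * t + (e + α) * t + (e * e + α * e + β)) - l * l * (t - e) - (t - u) * (t - v)
      q-at-e : ∀ α β l e u v →
        (e * e + (e + α) * e + (e * e + α * e + β)) - l * l * (e - e) - (e - u) * (e - v)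
        ≡ ((1ℚ + 1ℚ + 1ℚ) * e * e + (1ℚ + 1ℚ) * α * e + β) - (e - u) * (e - v)
      q-at-e = solve-∀ ℚ-ring
      divided : ∀ α β γ l m e u v t →
        (t - e) * ((t * t + (e + α) * t + (e * e + α * e + β)) - l * l * (t - e) - (t - u) * (t - v))
        ≡ ((t * t * t + α * t * t + β * t + γ - (l * t + m) * (l * t + m)) - (t - e) * (t - u) * (t - v))
          - (e * e * e + α * e * e + β * e + γ) + (1ℚ + 1ℚ) * l * (l * e + m) * (t - e) + (l * e + m) * (l * e + m)
      divided = solve-∀ ℚ-ring
      collapse : ∀ l t → 0ℚ - 0ℚ + (1ℚ + 1ℚ) * l * 0ℚ * t + 0ℚ * 0ℚ ≡ 0ℚ
      collapse = solve-∀ ℚ-ring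
      [t-e]q≡0 : ∀ t → (t - e) * q t ≡ 0ℚ
      [t-e]q≡0 t = begin
        (t - e) * q t ≡⟨ divided α β γ l m e u v t ⟩
        (residue l m t - (t - e) * (t - u) * (t - v)) - cubic e + (1ℚ + 1ℚ) * l * c * (t - e) + c * c
          ≡⟨ cong₂ (λ r z → r - z + (1ℚ + 1ℚ) * l * c * (t - e) + c * c) (p≡q⇒p-q≡0 (factors t)) root ⟩
        0ℚ - 0ℚ + (1ℚ + 1ℚ) * l * c * (t - e) + c * c
          ≡⟨ cong (λ z → 0ℚ - 0ℚ + (1ℚ + 1ℚ) * l * z * (t - e) + z * z) c≡0 ⟩
        0ℚ - 0ℚ + (1ℚ + 1ℚ) * l * 0ℚ * (t - e) + 0ℚ * 0ℚ ≡⟨ collapse l (t - e) ⟩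
        0ℚ ∎
      q-vanishes-off-e : ∀ d → d ≢ 0ℚ → q (e + d) ≡ 0ℚ
      q-vanishes-off-e d d≢0 = p≢0∧p*q≡0⇒q≡0 {d} {q (e + d)} d≢0
        (trans (cong (_* q (e + d)) (sym (shift e d))) ([t-e]q≡0 (e + d)))
        where shift : ∀ e d → (e + d) - e ≡ d
              shift = solve-∀ ℚ-ring
      linear : ∀ α β l e u v →
        (e * e + (e + α) * e + (e * e + α * e + β)) - l * l * (e - e) - (e - u) * (e - v)
        ≡ (1ℚ + 1ℚ) * (((e + 1ℚ) * (e + 1ℚ) + (e + α) * (e + 1ℚ) + (e * e + α * e + β))
                        - l * l * ((e + 1ℚ) - e) - ((e + 1ℚ) - u) * ((e + 1ℚ) - v))
          - (((e + (1ℚ + 1ℚ)) * (e + (1ℚ + 1ℚ)) + (e + α) * (e + (1ℚ + 1ℚ)) + (e * e + α * e + β))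
             - l * l * ((e + (1ℚ + 1ℚ)) - e) - ((e + (1ℚ + 1ℚ)) - u) * ((e + (1ℚ + 1ℚ)) - v))
      linear = solve-∀ ℚ-ring
      q[e]≡0 : q e ≡ 0ℚ
      q[e]≡0 = begin
        q e                                                ≡⟨ linear α β l e u v ⟩
        (1ℚ + 1ℚ) * q (e + 1ℚ) - q (e + (1ℚ + 1ℚ))         ≡⟨ cong₂ (λ a b → (1ℚ + 1ℚ) * a - b)
                                                               (q-vanishes-off-e 1ℚ (λ ())) (q-vanishes-off-e (1ℚ + 1ℚ) (λ ())) ⟩
        (1ℚ + 1ℚ) * 0ℚ - 0ℚ                                ≡⟨⟩
        0ℚ                                                 ∎

    factors-rotate : ∀ l m x₁ x₂ x₃ → Factors l m x₁ x₂ x₃ → Factors l m x₂ x₃ x₁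
    factors-rotate l m x₁ x₂ x₃ factors t = trans (factors t) (rotate t x₁ x₂ x₃)
      where rotate : ∀ t a b c → (t - a) * (t - b) * (t - c) ≡ (t - b) * (t - c) * (t - a)
            rotate = solve-∀ ℚ-ring

    root-first-κ-square : ∀ l m u v → Factors l m e u v → IsSquare (κ e * κ u * κ v)
    root-first-κ-square l m u v factors = cubic′ e , (begin
      κ e * κ u * κ v                ≡⟨ cong₂ (λ a b → κ e * a * b) (κ-off-root u≢e) (κ-off-root v≢e) ⟩
      κ e * (u - e) * (v - e)        ≡⟨ cong (λ a → a * (u - e) * (v - e)) (κ-at-root refl) ⟩
      cubic′ e * (u - e) * (v - e)   ≡⟨ flip-signs (cubic′ e) e u v ⟩
      cubic′ e * ((e - u) * (e - v)) ≡⟨ cong (cubic′ e *_) (sym cubic′≡) ⟩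
      cubic′ e * cubic′ e            ∎)
      where
      open ≡-Reasoning
      flip-signs : ∀ a e u v → a * (u - e) * (v - e) ≡ a * ((e - u) * (e - v))
      flip-signs = solve-∀ ℚ-ring
      cubic′≡ : cubic′ e ≡ (e - u) * (e - v)
      cubic′≡ = cubic′-at-root l m u v factors
      vanish₁ : ∀ e v → (e - e) * (e - v) ≡ 0ℚ
      vanish₁ = solve-∀ ℚ-ring
      vanish₂ : ∀ e u → (e - u) * (e - e) ≡ 0ℚ
      vanish₂ = solve-∀ ℚ-ring
      u≢e : u ≢ e
      u≢e u≡e = simple (trans cubic′≡ (trans (cong (λ z → (e - z) * (e - v)) u≡e) (vanish₁ e v)))
      v≢e : v ≢ e
      v≢e v≡e = simple (trans cubic′≡ (trans (cong (λ z → (e - u) * (e - z)) v≡e) (vanish₂ e u)))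

    chord-κ-square : ∀ l m x₁ x₂ x₃ → Factors l m x₁ x₂ x₃ → IsSquare (κ x₁ * κ x₂ * κ x₃)
    chord-κ-square l m x₁ x₂ x₃ factors = square (x₁ ≟ e) (x₂ ≟ e) (x₃ ≟ e)
      where
      at : ∀ y₁ y₂ y₃ → y₁ ≡ e → Factors l m y₁ y₂ y₃ → IsSquare (κ y₁ * κ y₂ * κ y₃)
      at _ y₂ y₃ refl = root-first-κ-square l m y₂ y₃
      rotate : ∀ a b c → a * b * c ≡ b * c * a
      rotate = solve-∀ ℚ-ring
      square : Dec (x₁ ≡ e) → Dec (x₂ ≡ e) → Dec (x₃ ≡ e) → IsSquare (κ x₁ * κ x₂ * κ x₃)
      square (yes x₁≡e) _ _ = at x₁ x₂ x₃ x₁≡e factors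
      square _ (yes x₂≡e) _ =
        subst IsSquare (sym (rotate (κ x₁) (κ x₂) (κ x₃)))
          (at x₂ x₃ x₁ x₂≡e (factors-rotate l m x₁ x₂ x₃ factors))
      square _ _ (yes x₃≡e) =
        subst IsSquare (rotate (κ x₃) (κ x₁) (κ x₂))
          (at x₃ x₁ x₂ x₃≡e (factors-rotate l m x₂ x₃ x₁ (factors-rotate l m x₁ x₂ x₃ factors)))
      square (no x₁≢e) (no x₂≢e) (no x₃≢e) = c , (begin
        κ x₁ * κ x₂ * κ x₃
          ≡⟨ cong₂ (λ a b → a * b * κ x₃) (κ-off-root x₁≢e) (κ-off-root x₂≢e) ⟩
        (x₁ - e) * (x₂ - e) * κ x₃        ≡⟨ cong ((x₁ - e) * (x₂ - e) *_) (κ-off-root x₃≢e) ⟩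
        (x₁ - e) * (x₂ - e) * (x₃ - e)    ≡⟨ flip-signs e x₁ x₂ x₃ ⟩
        - ((e - x₁) * (e - x₂) * (e - x₃)) ≡⟨ cong -_ (sym (factors e)) ⟩
        - (cubic e - c * c)               ≡⟨ cong (λ z → - (z - c * c)) root ⟩
        - (0ℚ - c * c)                    ≡⟨ neg-neg (c * c) ⟩
        c * c                             ∎)
        where
        open ≡-Reasoning
        c = l * e + m
        flip-signs : ∀ e x₁ x₂ x₃ → (x₁ - e) * (x₂ - e) * (x₃ - e) ≡ - ((e - x₁) * (e - x₂) * (e - x₃))
        flip-signs = solve-∀ ℚ-ring
        neg-neg : ∀ a → - (0ℚ - a) ≡ a
        neg-neg = solve-∀ ℚ-ring

    collinear-κ-square : ∀ P Q R → OnCurve E P → OnCurve E Q → Collinear P Q R →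
      IsSquare (κₚ P * κₚ Q * κₚ R)
    collinear-κ-square O Q R _ _ Q≡-R =
      κₚ R , trans (cong (λ z → 1ℚ * z * κₚ R) (trans (cong κₚ Q≡-R) (κₚ-neg R))) (unit (κₚ R))
      where unit : ∀ a → 1ℚ * a * a ≡ a * a
            unit = solve-∀ ℚ-ring
    collinear-κ-square (aff x y) O R _ _ P≡-R =
      κ x , trans (cong (κ x * 1ℚ *_) (sym (trans (cong κₚ P≡-R) (κₚ-neg R)))) (unit (κ x))
      where unit : ∀ a → a * 1ℚ * a ≡ a * a
            unit = solve-∀ ℚ-ring
    collinear-κ-square (aff x₁ y₁) (aff x₂ y₂) R on₁ on₂ sum≡-R = square (addition on₁ on₂)
      where
      square : Addition x₁ y₁ x₂ y₂ → IsSquare (κ x₁ * κ x₂ * κₚ R)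
      square (vertical x₁≡x₂ _ sum≡O) =
        κ x₁ , trans (cong₂ (λ a S → κ x₁ * κ a * κₚ S) (sym x₁≡x₂) (neg≡O⇒≡O R (trans (sym sum≡-R) sum≡O)))
                     (unit (κ x₁))
        where unit : ∀ a → a * a * 1ℚ ≡ a * a
              unit = solve-∀ ℚ-ring
      square (chord L) =
        subst (λ S → IsSquare (κ x₁ * κ x₂ * κₚ S)) R≡third
          (chord-κ-square slope intercept x₁ x₂ third factorisation)
        where
        open Chord L
        R≡third : aff third third-y ≡ R
        R≡third = trans (sym (neg-involutive (aff third third-y))) (neg-flip (trans (sym sum) sum≡-R))

    κ-successive : ∀ P → OnCurve E P → ∀ n → IsSquare (κₚ P * κₚ (smul E n P) * κₚ (smul E (suc n) P))
    κ-successive P on n =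
      subst (λ z → IsSquare (κₚ P * κₚ (smul E n P) * z)) (κₚ-neg (smul E (suc n) P))
        (collinear-κ-square P (smul E n P) (neg (smul E (suc n) P)) on (smul-closed n P on)
          (sym (neg-involutive (smul E (suc n) P))))

    -- κ (n P) ≡ κ(P)ⁿ modulo squares, recorded separately for even and odd n.
    κ-multiples : ∀ P → OnCurve E P → ∀ k →
      IsSquare (κₚ (smul E (k ℕ.* 2) P)) × IsSquare (κₚ P * κₚ (smul E (suc (k ℕ.* 2)) P))
    κ-multiples P on zero = (1ℚ , refl) , (κₚ P , cong (κₚ P *_) (κₚ-add-O P))
      where κₚ-add-O : ∀ P → κₚ (add E P O) ≡ κₚ P
            κₚ-add-O O         = refl
            κₚ-add-O (aff _ _) = refl
    κ-multiples P on (suc k) = even-square , odd-square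
      where
      a = κₚ P
      b = κₚ (smul E (suc (k ℕ.* 2)) P)
      c = κₚ (smul E (suc k ℕ.* 2) P)
      d = κₚ (smul E (suc (suc k ℕ.* 2)) P)
      reorder₁ : ∀ a b c → a * b * c ≡ c * (a * b)
      reorder₁ = solve-∀ ℚ-ring
      reorder₂ : ∀ a c d → a * c * d ≡ (a * d) * c
      reorder₂ = solve-∀ ℚ-ring
      even-square : IsSquare c
      even-square = square-cancelʳ c (a * b)
        (subst IsSquare (reorder₁ a b c) (κ-successive P on (suc (k ℕ.* 2))))
        (proj₂ (κ-multiples P on k)) (p*q≢0 (κₚ≢0 P) (κₚ≢0 (smul E (suc (k ℕ.* 2)) P)))
      odd-square : IsSquare (a * d)
      odd-square = square-cancelʳ (a * d) c
        (subst IsSquare (reorder₂ a c d) (κ-successive P on (suc k ℕ.* 2)))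
        even-square (κₚ≢0 (smul E (suc k ℕ.* 2) P))

  two-torsion : ∀ Q → OnCurve E Q → Q ≢ O → Q ≡ neg Q → Σ ℚ λ x → Q ≡ aff x 0ℚ × cubic x ≡ 0ℚ
  two-torsion O         _  Q≢O _ = ⊥-elim (Q≢O refl)
  two-torsion (aff x y) on _   Q≡-Q = x , cong (aff x) y≡0 , trans (sym on) (cong (λ u → u * u) y≡0)
    where y≡0 : y ≡ 0ℚ
          y≡0 = p≡-p⇒p≡0 (cong (λ { O → y ; (aff _ v) → v }) Q≡-Q)

  order-8⇒descent-squares : NonSingular → ∀ P → OnCurve E P → HasOrder E P 8 →
    Σ ℚ λ x₄ → cubic x₄ ≡ 0ℚ × (∀ e → cubic e ≡ 0ℚ → x₄ ≢ e → IsSquare (x₄ - e))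
  order-8⇒descent-squares ns P on (_ , 8P≡O , minimal) = x₄ , cubic≡0 , squares
    where
    4P = smul E 4 P
    torsion = two-torsion 4P (smul-closed 4 P on) (minimal 4 (s≤s z≤n) (s≤s (s≤s (s≤s (s≤s (s≤s z≤n))))))
                          (smul-complement ns P on 8P≡O 4 4 refl)
    x₄ = proj₁ torsion
    4P≡ : 4P ≡ aff x₄ 0ℚ
    4P≡ = proj₁ (proj₂ torsion)
    cubic≡0 : cubic x₄ ≡ 0ℚ
    cubic≡0 = proj₂ (proj₂ torsion)
    squares : ∀ e → cubic e ≡ 0ℚ → x₄ ≢ e → IsSquare (x₄ - e)
    squares e root x₄≢e = subst IsSquare (trans (cong κₚ 4P≡) (κ-off-root x₄≢e)) (proj₁ (κ-multiples P on 2))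
      where open DescentMap e root (ns e root)

module FermatRightTriangle where

  open import Data.Nat
  open import Data.Nat.Properties
  open import Data.Nat.Divisibility
  open import Data.Nat.DivMod using (m/n*n≡m; _/_)
  open import Data.Nat.GCD using (gcd; gcd[m,n]∣m; gcd[m,n]∣n; gcd[m,n]≡0⇒m≡0; gcd[m,n]≡0⇒n≡0)
  open import Data.Nat.Primality using (irreducible[2]; euclidsLemma; prime[2])
  open import Data.Nat.Coprimality as Coprime using (Coprime; coprime-divisor; coprime-/gcd)
  open import Data.Nat.Tactic.RingSolver using (solve-∀)
  open import Data.Nat.Induction using (<-rec)
  open import Data.Empty using (⊥; ⊥-elim)
  open import Data.Product using (Σ; _×_; _,_; proj₁; proj₂)
  open import Data.Sum using (_⊎_; inj₁; inj₂; [_,_]′)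
  open import Relation.Binary.Definitions using (tri<; tri≈; tri>)
  open import Relation.Binary.PropositionalEquality
  open import Relation.Nullary using (yes; no; ¬_)
  open import Function using (_∘_)

  IsSquare : ℕ → Set
  IsSquare n = Σ ℕ λ s → n ≡ s * s

  m*m≡n*n⇒m≡n : ∀ {m n} → m * m ≡ n * n → m ≡ n
  m*m≡n*n⇒m≡n {m} {n} mm≡nn with <-cmp m n
  ... | tri< m<n _ _ = ⊥-elim (<-irrefl mm≡nn (*-mono-< m<n m<n))
  ... | tri≈ _ m≡n _ = m≡n
  ... | tri> _ _ n<m = ⊥-elim (<-irrefl (sym mm≡nn) (*-mono-< n<m n<m))

  m*m≤n*n⇒m≤n : ∀ {m n} → m * m ≤ n * n → m ≤ n
  m*m≤n*n⇒m≤n {m} {n} mm≤nn with m ≤? n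
  ... | yes m≤n = m≤n
  ... | no  m≰n = ⊥-elim (<⇒≱ (*-mono-< (≰⇒> m≰n) (≰⇒> m≰n)) mm≤nn)

  n*n≡0⇒n≡0 : ∀ {n} → n * n ≡ 0 → n ≡ 0
  n*n≡0⇒n≡0 {zero} _ = refl

  coprime-*ˡ : ∀ {a b c} → Coprime a c → Coprime b c → Coprime (a * b) c
  coprime-*ˡ {a} {b} {c} a⊥c b⊥c {d} (d∣ab , d∣c) = b⊥c (d∣b , d∣c)
    where
    d⊥a : Coprime d a
    d⊥a {e} (e∣d , e∣a) = a⊥c (e∣a , ∣-trans e∣d d∣c)
    d∣b : d ∣ b
    d∣b = coprime-divisor d⊥a d∣ab

  record GCDFactorisation (m n : ℕ) : Set where
    field
      m′ n′ g : ℕ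
      .{{g≢0}} : NonZero g
      m≡m′g   : m ≡ m′ * g
      n≡n′g   : n ≡ n′ * g
      coprime : Coprime m′ n′

  gcd-factorisation : ∀ m n .{{_ : NonZero (gcd m n)}} → GCDFactorisation m n
  gcd-factorisation m n = record
    { m′ = m / gcd m n ; n′ = n / gcd m n ; g = gcd m n
    ; m≡m′g = sym (m/n*n≡m (gcd[m,n]∣m m n)) ; n≡n′g = sym (m/n*n≡m (gcd[m,n]∣n m n))
    ; coprime = coprime-/gcd m n }

  m*m∣n*n⇒m∣n : ∀ m n → m * m ∣ n * n → m ∣ n
  m*m∣n*n⇒m∣n m n mm∣nn with gcd m n ≟ 0
  ... | yes g≡0 = subst (m ∣_) (sym (gcd[m,n]≡0⇒n≡0 m g≡0)) (m ∣0)
  ... | no  g≢0 = subst (_∣ n) (sym m≡g) (gcd[m,n]∣n m n)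
    where
    instance _ = ≢-nonZero g≢0
    open GCDFactorisation (gcd-factorisation m n)
    instance _ = m*n≢0 g g
    regroup : ∀ a g → (a * g) * (a * g) ≡ (a * a) * (g * g)
    regroup = solve-∀
    m′m′∣n′n′ : m′ * m′ ∣ n′ * n′
    m′m′∣n′n′ = *-cancelʳ-∣ (g * g)
      (subst₂ _∣_ (trans (cong (λ z → z * z) m≡m′g) (regroup m′ g))
                  (trans (cong (λ z → z * z) n≡n′g) (regroup n′ g)) mm∣nn)
    m′≡1 : m′ ≡ 1
    m′≡1 = coprime (∣-refl , coprime-divisor coprime (∣-trans (n∣m*n m′) m′m′∣n′n′))
    m≡g : m ≡ g
    m≡g = trans m≡m′g (trans (cong (_* g) m′≡1) (*-identityˡ g))

  coprime-product-square : ∀ a b c → Coprime a b → a * b ≡ c * c → IsSquare a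
  coprime-product-square zero    b c _   _      = 0 , refl
  coprime-product-square a@(suc _) b c a⊥b ab≡cc = a′ , a≡a′a′
    where
    a≢0 : a ≢ 0
    a≢0 ()
    instance _ = ≢-nonZero (λ g≡0 → a≢0 (gcd[m,n]≡0⇒m≡0 {a} {c} g≡0))
    open GCDFactorisation (gcd-factorisation a c) renaming (m′ to a′; n′ to c′; m≡m′g to a≡a′g; n≡n′g to c≡c′g)
    instance _ = ≢-nonZero (λ a′≡0 → a≢0 (trans a≡a′g (cong (_* g) a′≡0)))
    shuffle₁ : ∀ a′ g b → a′ * g * b ≡ (a′ * b) * g
    shuffle₁ = solve-∀
    shuffle₂ : ∀ c′ g → c′ * g * (c′ * g) ≡ (g * (c′ * c′)) * g
    shuffle₂ = solve-∀
    a′b≡gc′c′ : a′ * b ≡ g * (c′ * c′)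
    a′b≡gc′c′ = *-cancelʳ-≡ (a′ * b) (g * (c′ * c′)) g (begin
      a′ * b * g          ≡⟨ sym (shuffle₁ a′ g b) ⟩
      a′ * g * b          ≡⟨ cong (_* b) (sym a≡a′g) ⟩
      a * b               ≡⟨ ab≡cc ⟩
      c * c               ≡⟨ cong (λ z → z * z) c≡c′g ⟩
      c′ * g * (c′ * g)   ≡⟨ shuffle₂ c′ g ⟩
      g * (c′ * c′) * g   ∎)
      where open ≡-Reasoning
    a′∣g : a′ ∣ g
    a′∣g = coprime-divisor (Coprime.sym (coprime-*ˡ (Coprime.sym coprime) (Coprime.sym coprime)))
             (subst (a′ ∣_) (trans a′b≡gc′c′ (*-comm g (c′ * c′))) (m∣m*n b))
    k = quotient a′∣g
    g≡ka′ : g ≡ k * a′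
    g≡ka′ = _∣_.equality a′∣g
    shuffle₃ : ∀ k a′ c′ → k * a′ * (c′ * c′) ≡ a′ * (k * (c′ * c′))
    shuffle₃ = solve-∀
    b≡kc′c′ : b ≡ k * (c′ * c′)
    b≡kc′c′ = *-cancelˡ-≡ b (k * (c′ * c′)) a′
      (trans a′b≡gc′c′ (trans (cong (_* (c′ * c′)) g≡ka′) (shuffle₃ k a′ c′)))
    k≡1 : k ≡ 1
    k≡1 = a⊥b (∣-trans (subst (k ∣_) (sym g≡ka′) (m∣m*n a′)) (subst (g ∣_) (sym a≡a′g) (n∣m*n a′)) ,
               subst (k ∣_) (sym b≡kc′c′) (m∣m*n (c′ * c′)))
    a≡a′a′ : a ≡ a′ * a′
    a≡a′a′ = trans a≡a′g (cong (a′ *_) (trans g≡ka′ (trans (cong (_* a′) k≡1) (*-identityˡ a′))))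

  data EvenOrOdd (n : ℕ) : Set where
    even : ∀ k → n ≡ 2 * k → EvenOrOdd n
    odd  : ∀ k → n ≡ 1 + 2 * k → EvenOrOdd n

  evenOrOdd : ∀ n → EvenOrOdd n
  evenOrOdd zero = even 0 refl
  evenOrOdd (suc n) with evenOrOdd n
  ... | even k n≡2k   = odd k (cong suc n≡2k)
  ... | odd  k n≡1+2k = even (suc k) (trans (cong suc n≡1+2k) (carry k))
    where carry : ∀ k → suc (1 + 2 * k) ≡ 2 * suc k
          carry = solve-∀

  Odd : ℕ → Set
  Odd n = Σ ℕ λ k → n ≡ 1 + 2 * k

  square-even : ∀ k → (2 * k) * (2 * k) ≡ 2 * (2 * (k * k))
  square-even = solve-∀

  square-odd : ∀ k → (1 + 2 * k) * (1 + 2 * k) ≡ 1 + 2 * (2 * (k * k + k))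
  square-odd = solve-∀

  odd-square⇒odd : ∀ {n} s → n * n ≡ 1 + 2 * s → Odd n
  odd-square⇒odd {n} s nn≡1+2s with evenOrOdd n
  ... | odd  k n≡1+2k = k , n≡1+2k
  ... | even k refl   = ⊥-elim (even≢odd (2 * (k * k)) s (trans (sym (square-even k)) nn≡1+2s))

  -- Such a sum is 2 mod 4.
  odd-squares-sum-not-square : ∀ i j c → (1 + 2 * i) * (1 + 2 * i) + (1 + 2 * j) * (1 + 2 * j) ≢ c * c
  odd-squares-sum-not-square i j c sum≡cc with evenOrOdd c
  ... | odd k refl = even≢odd (1 + 2 * s) (2 * (k * k + k)) (trans (sym (sum-shape i j)) (trans sum≡cc (square-odd k)))
    where s = i * i + i + j * j + j
          sum-shape : ∀ i j → (1 + 2 * i) * (1 + 2 * i) + (1 + 2 * j) * (1 + 2 * j) ≡ 2 * (1 + 2 * (i * i + i + j * j + j))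
          sum-shape = solve-∀
  ... | even k refl = even≢odd (k * k) (i * i + i + j * j + j)
        (sym (*-cancelˡ-≡ _ _ 2 (trans (sym (sum-shape i j)) (trans sum≡cc (square-even k)))))
    where sum-shape : ∀ i j → (1 + 2 * i) * (1 + 2 * i) + (1 + 2 * j) * (1 + 2 * j) ≡ 2 * (1 + 2 * (i * i + i + j * j + j))
          sum-shape = solve-∀

  pythagorean-parity : ∀ a b c → Coprime a b → a * a + b * b ≡ c * c →
    Odd c × ((Σ ℕ λ i → a ≡ 2 * i) × Odd b ⊎ Odd a × (Σ ℕ λ j → b ≡ 2 * j))
  pythagorean-parity a b c a⊥b sum≡cc with evenOrOdd a | evenOrOdd b
  ... | even i refl | even j refl = ⊥-elim (2≢1 (a⊥b (divides i (*-comm 2 i) , divides j (*-comm 2 j))))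
    where 2≢1 : 2 ≢ 1
          2≢1 ()
  ... | odd i refl | odd j refl = ⊥-elim (odd-squares-sum-not-square i j c sum≡cc)
  ... | even i refl | odd j refl =
    odd-square⇒odd (2 * (i * i + j * j + j)) (trans (sym sum≡cc) (sum-shape i j)) , inj₁ ((i , refl) , (j , refl))
    where sum-shape : ∀ i j → (2 * i) * (2 * i) + (1 + 2 * j) * (1 + 2 * j) ≡ 1 + 2 * (2 * (i * i + j * j + j))
          sum-shape = solve-∀
  ... | odd i refl | even j refl =
    odd-square⇒odd (2 * (i * i + i + j * j)) (trans (sym sum≡cc) (sum-shape i j)) , inj₂ ((i , refl) , (j , refl))
    where sum-shape : ∀ i j → (1 + 2 * i) * (1 + 2 * i) + (2 * j) * (2 * j) ≡ 1 + 2 * (2 * (i * i + i + j * j))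
          sum-shape = solve-∀

  ∣-legs⇒∣-hypotenuse : ∀ {d a b c} → d ∣ a → d ∣ b → a * a + b * b ≡ c * c → d ∣ c
  ∣-legs⇒∣-hypotenuse {d} {a} {b} {c} d∣a d∣b sum≡cc =
    m*m∣n*n⇒m∣n d c (subst (d * d ∣_) sum≡cc (∣m∣n⇒∣m+n (*-pres-∣ d∣a d∣a) (*-pres-∣ d∣b d∣b)))

  ∣-hypotenuse-leg⇒∣-leg : ∀ {d a b c} → d ∣ c → d ∣ a → a * a + b * b ≡ c * c → d ∣ b
  ∣-hypotenuse-leg⇒∣-leg {d} {a} {b} {c} d∣c d∣a sum≡cc =
    m*m∣n*n⇒m∣n d b (∣m+n∣m⇒∣n (subst (d * d ∣_) (sym sum≡cc) (*-pres-∣ d∣c d∣c)) (*-pres-∣ d∣a d∣a))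

  record PythagoreanParameters (a b c : ℕ) : Set where
    field
      M N        : ℕ
      coprime    : Coprime M N
      odd-leg    : a + N * N ≡ M * M
      half-leg   : b ≡ M * N
      hypotenuse : c ≡ M * M + N * N

  pythagorean-parameters-odd : ∀ i b t → Coprime (1 + 2 * i) (2 * b) →
    (1 + 2 * i) * (1 + 2 * i) + (2 * b) * (2 * b) ≡ (1 + 2 * (i + t)) * (1 + 2 * (i + t)) →
    PythagoreanParameters (1 + 2 * i) b (1 + 2 * (i + t))
  pythagorean-parameters-odd i b t a⊥2b sum≡cc = record
    { M = M ; N = N ; coprime = M⊥N ; odd-leg = odd-leg ; half-leg = half-leg ; hypotenuse = hypotenuse }
    where
    u = 1 + 2 * i
    expand-sum : ∀ i b → (1 + 2 * i) * (1 + 2 * i) + (2 * b) * (2 * b) ≡ (1 + 2 * i) * (1 + 2 * i) + 4 * (b * b)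
    expand-sum = solve-∀
    expand-c : ∀ i t → (1 + 2 * (i + t)) * (1 + 2 * (i + t)) ≡ (1 + 2 * i) * (1 + 2 * i) + 4 * (t * (t + (1 + 2 * i)))
    expand-c = solve-∀
    bb≡t[t+u] : b * b ≡ t * (t + u)
    bb≡t[t+u] = *-cancelˡ-≡ (b * b) (t * (t + u)) 4 (+-cancelˡ-≡ (u * u) (4 * (b * b)) (4 * (t * (t + u)))
      (trans (sym (expand-sum i b)) (trans sum≡cc (expand-c i t))))
    t⊥t+u : Coprime t (t + u)
    t⊥t+u {d} (d∣t , d∣t+u) = a⊥2b (∣m+n∣m⇒∣n d∣t+u d∣t , ∣n⇒∣m*n 2 d∣b)
      where d∣b : d ∣ b
            d∣b = m*m∣n*n⇒m∣n d b (subst (d * d ∣_) (sym bb≡t[t+u]) (*-pres-∣ d∣t d∣t+u))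
    t-square   = coprime-product-square t (t + u) b t⊥t+u (sym bb≡t[t+u])
    t+u-square = coprime-product-square (t + u) t b (Coprime.sym t⊥t+u) (trans (*-comm (t + u) t) (sym bb≡t[t+u]))
    N = proj₁ t-square
    M = proj₁ t+u-square
    t≡NN : t ≡ N * N
    t≡NN = proj₂ t-square
    t+u≡MM : t + u ≡ M * M
    t+u≡MM = proj₂ t+u-square
    regroup : ∀ M N → (M * N) * (M * N) ≡ (N * N) * (M * M)
    regroup = solve-∀
    half-leg : b ≡ M * N
    half-leg = m*m≡n*n⇒m≡n (trans bb≡t[t+u] (trans (cong₂ _*_ t≡NN t+u≡MM) (sym (regroup M N))))
    odd-leg : u + N * N ≡ M * M
    odd-leg = trans (cong (u +_) (sym t≡NN)) (trans (+-comm u t) t+u≡MM)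
    split : ∀ i t → 1 + 2 * (i + t) ≡ (t + (1 + 2 * i)) + t
    split = solve-∀
    hypotenuse : 1 + 2 * (i + t) ≡ M * M + N * N
    hypotenuse = trans (split i t) (cong₂ _+_ t+u≡MM t≡NN)
    M⊥N : Coprime M N
    M⊥N {d} (d∣M , d∣N) =
      t⊥t+u (subst (d ∣_) (sym t≡NN) (∣n⇒∣m*n N d∣N) , subst (d ∣_) (sym t+u≡MM) (∣n⇒∣m*n M d∣M))

  pythagorean-parameters : ∀ a b c → Coprime a (2 * b) → a * a + (2 * b) * (2 * b) ≡ c * c →
    PythagoreanParameters a b c
  pythagorean-parameters a b c a⊥2b sum≡cc with pythagorean-parity a (2 * b) c a⊥2b sum≡cc
  ... | _ , inj₁ (_ , (j , 2b≡1+2j)) = ⊥-elim (even≢odd b j 2b≡1+2j)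
  ... | (k , refl) , inj₂ ((i , refl) , _) with m≤n⇒∃[o]m+o≡n i≤k
    where
    i≤k : i ≤ k
    i≤k = *-cancelˡ-≤ 2 (+-cancelˡ-≤ 1 _ _ (m*m≤n*n⇒m≤n (subst ((1 + 2 * i) * (1 + 2 * i) ≤_) sum≡cc
            (m≤m+n ((1 + 2 * i) * (1 + 2 * i)) ((2 * b) * (2 * b))))))
  ...   | t , refl = pythagorean-parameters-odd i b t a⊥2b sum≡cc

  odd⇒∤2 : ∀ {n} → Odd n → ¬ (2 ∣ n)
  odd⇒∤2 {n} (k , n≡1+2k) (divides q n≡q*2) = even≢odd q k (trans (*-comm 2 q) (trans (sym n≡q*2) n≡1+2k))

  ∤2⇒coprime-2 : ∀ {n} → ¬ (2 ∣ n) → Coprime n 2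
  ∤2⇒coprime-2 {n} 2∤n {d} (d∣n , d∣2) with irreducible[2] d∣2
  ... | inj₁ d≡1 = d≡1
  ... | inj₂ refl = ⊥-elim (2∤n d∣n)

  record SquareSumAndDifference (x : ℕ) : Set where
    field
      y z w      : ℕ
      coprime    : Coprime x y
      y>0        : 0 < y
      difference : x * x ≡ y * y + w * w
      sum        : z * z ≡ x * x + y * y

  Descends : ℕ → Set
  Descends x = Σ ℕ λ x′ → x′ < x × SquareSumAndDifference x′

  n≤n⁴ : ∀ n → n ≤ n * n * (n * n)
  n≤n⁴ zero      = z≤n
  n≤n⁴ n@(suc _) = subst (n ≤_) (sym (*-assoc n n (n * n))) (m≤m*n n (n * (n * n)))
    where instance _ = m*n≢0 n (n * n)

  ∣-coprime : ∀ {d m n} → d ∣ m → Coprime m n → Coprime d n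
  ∣-coprime d∣m m⊥n (e∣d , e∣n) = m⊥n (∣-trans e∣d d∣m , e∣n)

  coprime-to-difference : ∀ {k M N} → Coprime M N → k + N * N ≡ M * M → Coprime M k × Coprime N k
  coprime-to-difference {k} {M} {N} M⊥N k+NN≡MM = M⊥k , N⊥k
    where
    M⊥k : Coprime M k
    M⊥k {d} (d∣M , d∣k) = M⊥N (d∣M , coprime-divisor (∣-coprime d∣M M⊥N) d∣NN)
      where d∣NN : d ∣ N * N
            d∣NN = ∣m+n∣m⇒∣n (subst (d ∣_) (sym k+NN≡MM) (∣n⇒∣m*n M d∣M)) d∣k
    N⊥k : Coprime N k
    N⊥k {d} (d∣N , d∣k) = M⊥N (coprime-divisor (∣-coprime d∣N (Coprime.sym M⊥N)) d∣MM , d∣N)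
      where d∣MM : d ∣ M * M
            d∣MM = subst (d ∣_) k+NN≡MM (∣m∣n⇒∣m+n d∣k (∣n⇒∣m*n N d∣N))

  odd-sum-of-squares⇒odd-sum : ∀ {x M N} → Odd x → x ≡ M * M + N * N → Odd (M + N)
  odd-sum-of-squares⇒odd-sum {x} {M} {N} (x′ , x≡1+2x′) x≡MM+NN = odd-square⇒odd (x′ + M * N) (begin
    (M + N) * (M + N)            ≡⟨ expand M N ⟩
    M * M + N * N + 2 * (M * N)  ≡⟨ cong (_+ 2 * (M * N)) (trans (sym x≡MM+NN) x≡1+2x′) ⟩
    1 + 2 * x′ + 2 * (M * N)     ≡⟨ regroup x′ M N ⟩
    1 + 2 * (x′ + M * N)         ∎)
    where
    open ≡-Reasoning
    expand : ∀ M N → (M + N) * (M + N) ≡ M * M + N * N + 2 * (M * N)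
    expand = solve-∀
    regroup : ∀ x′ M N → 1 + 2 * x′ + 2 * (M * N) ≡ 1 + 2 * (x′ + M * N)
    regroup = solve-∀

  -- For M = N + p, the factors p and N + N + p = M + N of M² - N² can only
  -- share the factor 2, which M + N odd excludes.
  coprime-difference-factors : ∀ {M N p} → Coprime M N → Odd (M + N) → N + p ≡ M → Coprime p (N + N + p)
  coprime-difference-factors {M} {N} {p} M⊥N M+N-odd N+p≡M {d} (d∣p , d∣N+N+p) = M⊥N (d∣M , d∣N)
    where
    rearrange : ∀ N p → N + N + p ≡ (N + p) + N
    rearrange = solve-∀
    d∣M+N : d ∣ M + N
    d∣M+N = subst (d ∣_) (trans (rearrange N p) (cong (_+ N) N+p≡M)) d∣N+N+p
    d⊥2 : Coprime d 2
    d⊥2 = ∤2⇒coprime-2 (λ 2∣d → odd⇒∤2 M+N-odd (∣-trans 2∣d d∣M+N))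
    double : ∀ N → N + N ≡ 2 * N
    double = solve-∀
    d∣N : d ∣ N
    d∣N = coprime-divisor d⊥2 (subst (d ∣_) (double N) (∣m+n∣m⇒∣n (subst (d ∣_) (+-comm (N + N) p) d∣N+N+p) d∣p))
    d∣M : d ∣ M
    d∣M = subst (d ∣_) N+p≡M (∣m∣n⇒∣m+n d∣N d∣p)

  -- M, N and k = M² - N² are pairwise coprime with k M N a square, so
  -- M = α², N = β² and k = p (M + N) with M = N + p; the two factors of k
  -- are coprime squares δ², γ², giving α² = β² + δ² and γ² = α² + β².
  smaller-solution : ∀ {x k M N ŷ} → Odd x → x ≡ M * M + N * N → k + N * N ≡ M * M → Coprime M N →
    k * (M * N) ≡ ŷ * ŷ → 0 < ŷ → Descends x
  smaller-solution {x} {k} {M} {N} {ŷ} x-odd x≡MM+NN k+NN≡MM M⊥N kMN≡ŷŷ ŷ>0 =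
    α , α<x , record
      { y = β ; z = γ ; w = δ ; coprime = α⊥β ; y>0 = β>0 ; difference = αα≡ββ+δδ ; sum = γγ≡αα+ββ }
    where
    MN⊥k : Coprime (M * N) k
    MN⊥k = let M⊥k , N⊥k = coprime-to-difference M⊥N k+NN≡MM in coprime-*ˡ M⊥k N⊥k
    MN-square = coprime-product-square (M * N) k ŷ MN⊥k (trans (*-comm (M * N) k) kMN≡ŷŷ)
    k-square  = coprime-product-square k (M * N) ŷ (Coprime.sym MN⊥k) kMN≡ŷŷ
    M-square  = coprime-product-square M N (proj₁ MN-square) M⊥N (proj₂ MN-square)
    N-square  = coprime-product-square N M (proj₁ MN-square) (Coprime.sym M⊥N) (trans (*-comm N M) (proj₂ MN-square))
    α = proj₁ M-square
    β = proj₁ N-square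
    M≡αα : M ≡ α * α
    M≡αα = proj₂ M-square
    N≡ββ : N ≡ β * β
    N≡ββ = proj₂ N-square
    N≤M : N ≤ M
    N≤M = m*m≤n*n⇒m≤n (subst (N * N ≤_) k+NN≡MM (m≤n+m (N * N) k))
    p = proj₁ (m≤n⇒∃[o]m+o≡n N≤M)
    N+p≡M : N + p ≡ M
    N+p≡M = proj₂ (m≤n⇒∃[o]m+o≡n N≤M)
    expand : ∀ N p → (N + p) * (N + p) ≡ p * (N + N + p) + N * N
    expand = solve-∀
    p[N+N+p]≡kk : p * (N + N + p) ≡ proj₁ k-square * proj₁ k-square
    p[N+N+p]≡kk = trans (sym (+-cancelʳ-≡ (N * N) k (p * (N + N + p))
      (trans k+NN≡MM (trans (cong (λ z → z * z) (sym N+p≡M)) (expand N p))))) (proj₂ k-square)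
    p⊥N+N+p : Coprime p (N + N + p)
    p⊥N+N+p = coprime-difference-factors M⊥N (odd-sum-of-squares⇒odd-sum {x} {M} {N} x-odd x≡MM+NN) N+p≡M
    p-square   = coprime-product-square p (N + N + p) (proj₁ k-square) p⊥N+N+p p[N+N+p]≡kk
    sum-square = coprime-product-square (N + N + p) p (proj₁ k-square) (Coprime.sym p⊥N+N+p)
                   (trans (*-comm (N + N + p) p) p[N+N+p]≡kk)
    δ = proj₁ p-square
    γ = proj₁ sum-square
    rearrange : ∀ N p → N + N + p ≡ (N + p) + N
    rearrange = solve-∀
    αα≡ββ+δδ : α * α ≡ β * β + δ * δ
    αα≡ββ+δδ = trans (sym M≡αα) (trans (sym N+p≡M) (cong₂ _+_ N≡ββ (proj₂ p-square)))
    γγ≡αα+ββ : γ * γ ≡ α * α + β * β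
    γγ≡αα+ββ = trans (sym (proj₂ sum-square)) (trans (rearrange N p) (cong₂ _+_ (trans N+p≡M M≡αα) N≡ββ))
    α⊥β : Coprime α β
    α⊥β {d} (d∣α , d∣β) =
      M⊥N (subst (d ∣_) (sym M≡αα) (∣m⇒∣m*n α d∣α) , subst (d ∣_) (sym N≡ββ) (∣m⇒∣m*n β d∣β))
    N≢0 : N ≢ 0
    N≢0 N≡0 = <⇒≢ ŷ>0 (sym (n*n≡0⇒n≡0 (trans (sym kMN≡ŷŷ) (trans (cong (λ z → k * (M * z)) N≡0) (vanish k M)))))
      where vanish : ∀ k M → k * (M * 0) ≡ 0
            vanish = solve-∀
    β>0 : 0 < β
    β>0 with β | N≡ββ
    ... | zero  | N≡0 = ⊥-elim (N≢0 N≡0)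
    ... | suc _ | _   = z<s
    α<x : α < x
    α<x = begin-strict
      α                    ≤⟨ n≤n⁴ α ⟩
      α * α * (α * α)      ≡⟨ cong₂ _*_ M≡αα M≡αα ⟨
      M * M                <⟨ m<m+n (M * M) (n≢0⇒n>0 (N≢0 ∘ n*n≡0⇒n≡0)) ⟩
      M * M + N * N        ≡⟨ x≡MM+NN ⟨
      x                    ∎
      where open ≤-Reasoning

  legs-coprime : ∀ {x y w} → Coprime x y → x * x ≡ y * y + w * w → Coprime y w
  legs-coprime x⊥y difference (d∣y , d∣w) = x⊥y (∣-legs⇒∣-hypotenuse d∣y d∣w (sym difference) , d∣y)

  descent-from-even-leg : ∀ x′ ŷ → 0 < ŷ → ∀ a b → Coprime a b →
    a * a + b * b ≡ (1 + 2 * x′) * (1 + 2 * x′) → a * b ≡ 2 * (ŷ * ŷ) → 2 ∣ b → Descends (1 + 2 * x′)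
  descent-from-even-leg x′ ŷ ŷ>0 a b a⊥b aa+bb≡XX ab≡2ŷŷ (divides b₂ b≡b₂*2) =
    smaller-solution (x′ , refl) hypotenuse odd-leg coprime a[MN]≡ŷŷ ŷ>0
    where
    b≡2b₂ : b ≡ 2 * b₂
    b≡2b₂ = trans b≡b₂*2 (*-comm b₂ 2)
    open PythagoreanParameters (pythagorean-parameters a b₂ (1 + 2 * x′)
      (subst (Coprime a) b≡2b₂ a⊥b) (subst (λ b → a * a + b * b ≡ (1 + 2 * x′) * (1 + 2 * x′)) b≡2b₂ aa+bb≡XX))
    shuffle : ∀ a c → 2 * (a * c) ≡ a * (2 * c)
    shuffle = solve-∀
    a[MN]≡ŷŷ : a * (M * N) ≡ ŷ * ŷ
    a[MN]≡ŷŷ = *-cancelˡ-≡ (a * (M * N)) (ŷ * ŷ) 2 (begin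
      2 * (a * (M * N)) ≡⟨ shuffle a (M * N) ⟩
      a * (2 * (M * N)) ≡⟨ cong (λ c → a * (2 * c)) half-leg ⟨
      a * (2 * b₂)      ≡⟨ cong (a *_) b≡2b₂ ⟨
      a * b             ≡⟨ ab≡2ŷŷ ⟩
      2 * (ŷ * ŷ)       ∎)
      where open ≡-Reasoning

  -- With Z = W + 2 v, the numbers u = W + v and v satisfy u v = Y² / 2 and
  -- u² + v² = X², so one of them is an even leg of a primitive triple with
  -- hypotenuse X.
  descent-step-with-parities : ∀ x′ ŷ w′ z′ → Coprime (1 + 2 * x′) (2 * ŷ) → 0 < ŷ →
    (1 + 2 * x′) * (1 + 2 * x′) ≡ (2 * ŷ) * (2 * ŷ) + (1 + 2 * w′) * (1 + 2 * w′) →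
    (1 + 2 * z′) * (1 + 2 * z′) ≡ (1 + 2 * x′) * (1 + 2 * x′) + (2 * ŷ) * (2 * ŷ) →
    Descends (1 + 2 * x′)
  descent-step-with-parities x′ ŷ w′ z′ X⊥Y ŷ>0 difference sum with m≤n⇒∃[o]m+o≡n w′≤z′
    where
    W≤Z : 1 + 2 * w′ ≤ 1 + 2 * z′
    W≤Z = m*m≤n*n⇒m≤n (begin
      (1 + 2 * w′) * (1 + 2 * w′)                       ≤⟨ m≤n+m _ ((2 * ŷ) * (2 * ŷ)) ⟩
      (2 * ŷ) * (2 * ŷ) + (1 + 2 * w′) * (1 + 2 * w′)   ≡⟨ difference ⟨
      (1 + 2 * x′) * (1 + 2 * x′)                       ≤⟨ m≤m+n _ ((2 * ŷ) * (2 * ŷ)) ⟩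
      (1 + 2 * x′) * (1 + 2 * x′) + (2 * ŷ) * (2 * ŷ)   ≡⟨ sum ⟨
      (1 + 2 * z′) * (1 + 2 * z′)                       ∎)
      where open ≤-Reasoning
    w′≤z′ : w′ ≤ z′
    w′≤z′ = *-cancelˡ-≤ 2 (+-cancelˡ-≤ 1 _ _ W≤Z)
  ... | v , refl =
    [ descent-from-even-leg x′ ŷ ŷ>0 v u (Coprime.sym u⊥v)
        (trans (+-comm (v * v) (u * u)) uu+vv≡XX) (trans (*-comm v u) uv≡2ŷŷ)
    , descent-from-even-leg x′ ŷ ŷ>0 u v u⊥v uu+vv≡XX uv≡2ŷŷ
    ]′ (euclidsLemma u v prime[2] (divides (ŷ * ŷ) (trans uv≡2ŷŷ (*-comm 2 (ŷ * ŷ)))))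
    where
    X = 1 + 2 * x′
    Y = 2 * ŷ
    W = 1 + 2 * w′
    u = W + v
    expand-Z : ∀ w′ v →
      (1 + 2 * (w′ + v)) * (1 + 2 * (w′ + v)) ≡ (1 + 2 * w′) * (1 + 2 * w′) + 4 * ((1 + 2 * w′ + v) * v)
    expand-Z = solve-∀
    expand-sum : ∀ ŷ W → (2 * ŷ) * (2 * ŷ) + W * W + (2 * ŷ) * (2 * ŷ) ≡ W * W + 4 * (2 * (ŷ * ŷ))
    expand-sum = solve-∀
    uv≡2ŷŷ : u * v ≡ 2 * (ŷ * ŷ)
    uv≡2ŷŷ = *-cancelˡ-≡ (u * v) (2 * (ŷ * ŷ)) 4 (+-cancelˡ-≡ (W * W) (4 * (u * v)) (4 * (2 * (ŷ * ŷ)))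
      (trans (sym (expand-Z w′ v)) (trans sum (trans (cong (_+ Y * Y) difference) (expand-sum ŷ W)))))
    expand-uv : ∀ W v → (W + v) * (W + v) + v * v ≡ W * W + 2 * ((W + v) * v)
    expand-uv = solve-∀
    regroup : ∀ W ŷ → W * W + 2 * (2 * (ŷ * ŷ)) ≡ (2 * ŷ) * (2 * ŷ) + W * W
    regroup = solve-∀
    uu+vv≡XX : u * u + v * v ≡ X * X
    uu+vv≡XX = trans (expand-uv W v) (trans (cong (λ z → W * W + 2 * z) uv≡2ŷŷ) (trans (regroup W ŷ) (sym difference)))
    u⊥v : Coprime u v
    u⊥v {d} (d∣u , d∣v) = X⊥Y (d∣X , ∣-hypotenuse-leg⇒∣-leg d∣X d∣W (trans (+-comm (W * W) (Y * Y)) (sym difference)))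
      where
      d∣W : d ∣ W
      d∣W = ∣m+n∣m⇒∣n (subst (d ∣_) (+-comm W v) d∣u) d∣v
      d∣X : d ∣ X
      d∣X = ∣-legs⇒∣-hypotenuse d∣u d∣v uu+vv≡XX

  descent-step : ∀ {x} → SquareSumAndDifference x → Descends x
  descent-step {x} record { y = y ; z = z ; w = w ; coprime = x⊥y ; y>0 = y>0 ; difference = difference ; sum = sum }
    with pythagorean-parity x y z x⊥y (sym sum) | pythagorean-parity y w x (legs-coprime x⊥y difference) (sym difference)
  ... | _ , inj₁ ((i , x≡2i) , _) | (k , x≡1+2k) , _ = ⊥-elim (even≢odd i k (trans (sym x≡2i) x≡1+2k))
  ... | _ , inj₂ (_ , (j , y≡2j)) | _ , inj₂ ((k , y≡1+2k) , _) = ⊥-elim (even≢odd j k (trans (sym y≡2j) y≡1+2k))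
  ... | (z′ , refl) , inj₂ (_ , (ŷ , refl)) | (x′ , refl) , inj₁ (_ , (w′ , refl)) =
    descent-step-with-parities x′ ŷ w′ z′ x⊥y (positive-half y>0) difference sum
    where positive-half : ∀ {ŷ} → 0 < 2 * ŷ → 0 < ŷ
          positive-half {suc _} _ = z<s

  no-square-sum-and-difference : ∀ x → ¬ SquareSumAndDifference x
  no-square-sum-and-difference = <-rec (λ x → ¬ SquareSumAndDifference x) descend
    where
    descend : ∀ x → (∀ {x′} → x′ < x → ¬ SquareSumAndDifference x′) → ¬ SquareSumAndDifference x
    descend x smaller s with descent-step s
    ... | x′ , x′<x , s′ = smaller x′<x s′

open import Defs
open import Data.Nat as ℕ using (ℕ; suc; _<_; z<s)
import Data.Nat.Properties as ℕ
open import Data.Nat.Divisibility using (_∣_; ∣-refl; ∣m+n∣m⇒∣n; n∣m*n; ∣1⇒≡1)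
open import Data.Nat.GCD using (gcd; gcd-greatest)
open import Data.Nat.Coprimality using (Coprime) renaming (sym to Coprime-sym)
open import Data.Integer as ℤ using (+_; -[1+_]; ∣_∣)
import Data.Integer.Properties as ℤ
open import Data.Rational using (ℚ; mkℚ; 0ℚ; 1ℚ; _+_; _*_; _-_; -_; _/_; toℚᵘ)
open import Data.Rational.Properties using (toℚᵘ-cong; toℚᵘ-fromℚᵘ; toℚᵘ-homo-+; toℚᵘ-homo-*; toℚᵘ-homo‿-)
open import Data.Rational.Unnormalised as ℚᵘ using (mkℚᵘ; _≃_; *≡*)
import Data.Rational.Unnormalised.Properties as ℚᵘ
open import Data.Empty using (⊥)
open import Data.Product using (Σ; _×_; _,_; proj₁; proj₂)
open import Data.Sum as Sum using (_⊎_; inj₁; inj₂; [_,_]′)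
open import Function using (_∘_)
open import Relation.Nullary using (¬_)
open import Relation.Binary.PropositionalEquality
open import Tactic.RingSolver using (solve-∀)
import Data.Integer.Tactic.RingSolver as ℤ-Solver
import Data.Nat.Tactic.RingSolver as ℕ-Solver
open RationalField
open FermatRightTriangle
  using (m*m≡n*n⇒m≡n; m*m∣n*n⇒m∣n; n*n≡0⇒n≡0; ∣-legs⇒∣-hypotenuse; no-square-sum-and-difference)

⟦_⟧ : ℕ → ℚ
⟦ n ⟧ = + n / 1

⟦⟧-injective : ∀ {m n} → ⟦ m ⟧ ≡ ⟦ n ⟧ → m ≡ n
⟦⟧-injective {m} {n} ⟦m⟧≡⟦n⟧ with ℚᵘ.≃-trans (ℚᵘ.≃-sym (toℚᵘ-fromℚᵘ (mkℚᵘ (+ m) 0)))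
                                   (ℚᵘ.≃-trans (toℚᵘ-cong ⟦m⟧≡⟦n⟧) (toℚᵘ-fromℚᵘ (mkℚᵘ (+ n) 0)))
... | *≡* m*1≡n*1 = ℤ.+-injective (trans (sym (ℤ.*-identityʳ (+ m))) (trans m*1≡n*1 (ℤ.*-identityʳ (+ n))))

-- Writing s = p / D in lowest terms, m - n = s² becomes m D² = n D² + p².
cleared-denominator : ∀ m n s → ⟦ m ⟧ - ⟦ n ⟧ ≡ s * s →
  Σ ℕ λ D → Σ ℕ λ Q → 0 < D × m ℕ.* (D ℕ.* D) ≡ n ℕ.* (D ℕ.* D) ℕ.+ Q ℕ.* Q
cleared-denominator m n s@(mkℚ p d-1 _) m-n≡ss = suc d-1 , ∣ p ∣ , z<s , ℤ.+-injective (begin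
  + (m ℕ.* DD)                                     ≡⟨ ℤ.pos-* m DD ⟩
  + m ℤ.* + DD                                     ≡⟨ split (+ m) (+ n) (+ DD) ⟩
  (+ m ℤ.* ℤ.1ℤ ℤ.+ (ℤ.- + n) ℤ.* ℤ.1ℤ) ℤ.* + DD ℤ.+ + n ℤ.* + DD
    ≡⟨ cong (ℤ._+ + n ℤ.* + DD) cross-multiplied ⟩
  (p ℤ.* p) ℤ.* ℤ.1ℤ ℤ.+ + n ℤ.* + DD              ≡⟨ swap (p ℤ.* p) (+ n) (+ DD) ⟩
  + n ℤ.* + DD ℤ.+ p ℤ.* p                         ≡⟨ cong₂ ℤ._+_ (sym (ℤ.pos-* n DD)) (square-∣∣ p) ⟩
  + (n ℕ.* DD) ℤ.+ + (∣ p ∣ ℕ.* ∣ p ∣)             ≡⟨ sym (ℤ.pos-+ (n ℕ.* DD) (∣ p ∣ ℕ.* ∣ p ∣)) ⟩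
  + (n ℕ.* DD ℕ.+ ∣ p ∣ ℕ.* ∣ p ∣)                 ∎)
  where
  open ≡-Reasoning
  DD = suc d-1 ℕ.* suc d-1
  unnormalised : (mkℚᵘ (+ m) 0 ℚᵘ.+ ℚᵘ.- mkℚᵘ (+ n) 0) ≃ (mkℚᵘ p d-1 ℚᵘ.* mkℚᵘ p d-1)
  unnormalised =
    ℚᵘ.≃-trans
      (ℚᵘ.≃-sym (ℚᵘ.+-cong (toℚᵘ-fromℚᵘ (mkℚᵘ (+ m) 0)) (ℚᵘ.-‿cong (toℚᵘ-fromℚᵘ (mkℚᵘ (+ n) 0)))))
    (ℚᵘ.≃-trans (ℚᵘ.≃-sym (ℚᵘ.+-cong (ℚᵘ.≃-refl {toℚᵘ ⟦ m ⟧}) (toℚᵘ-homo‿- ⟦ n ⟧)))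
    (ℚᵘ.≃-trans (ℚᵘ.≃-sym (toℚᵘ-homo-+ ⟦ m ⟧ (- ⟦ n ⟧)))
    (ℚᵘ.≃-trans (toℚᵘ-cong m-n≡ss) (toℚᵘ-homo-* s s))))
  cross-multiplied : (+ m ℤ.* ℤ.1ℤ ℤ.+ (ℤ.- + n) ℤ.* ℤ.1ℤ) ℤ.* + DD ≡ (p ℤ.* p) ℤ.* + (1 ℕ.* 1)
  cross-multiplied with unnormalised
  ... | *≡* eq = eq
  split : ∀ M N DD → M ℤ.* DD ≡ (M ℤ.* ℤ.1ℤ ℤ.+ (ℤ.- N) ℤ.* ℤ.1ℤ) ℤ.* DD ℤ.+ N ℤ.* DD
  split = ℤ-Solver.solve-∀
  swap : ∀ Q N DD → Q ℤ.* ℤ.1ℤ ℤ.+ N ℤ.* DD ≡ N ℤ.* DD ℤ.+ Q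
  swap = ℤ-Solver.solve-∀
  square-∣∣ : ∀ p → p ℤ.* p ≡ + (∣ p ∣ ℕ.* ∣ p ∣)
  square-∣∣ (+ k)    = sym (ℤ.pos-* k k)
  square-∣∣ -[1+ k ] = refl

integral-square-difference : ∀ m n s → ⟦ m ⟧ - ⟦ n ⟧ ≡ s * s → Σ ℕ λ w → m ≡ n ℕ.+ w ℕ.* w
integral-square-difference m n s m-n≡ss with cleared-denominator m n s m-n≡ss
... | D@(suc _) , Q , _ , cleared = w , ℕ.*-cancelʳ-≡ m (n ℕ.+ w ℕ.* w) (D ℕ.* D) (begin
  m ℕ.* (D ℕ.* D)                          ≡⟨ cleared ⟩
  n ℕ.* (D ℕ.* D) ℕ.+ Q ℕ.* Q              ≡⟨ cong (λ z → n ℕ.* (D ℕ.* D) ℕ.+ z ℕ.* z) Q≡wD ⟩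
  n ℕ.* (D ℕ.* D) ℕ.+ w ℕ.* D ℕ.* (w ℕ.* D) ≡⟨ regroup n w D ⟩
  (n ℕ.+ w ℕ.* w) ℕ.* (D ℕ.* D)            ∎)
  where
  open ≡-Reasoning
  D∣Q : D ∣ Q
  D∣Q = m*m∣n*n⇒m∣n D Q (∣m+n∣m⇒∣n (subst (D ℕ.* D ∣_) cleared (n∣m*n m)) (n∣m*n n))
  w = _∣_.quotient D∣Q
  Q≡wD : Q ≡ w ℕ.* D
  Q≡wD = _∣_.equality D∣Q
  regroup : ∀ n w D → n ℕ.* (D ℕ.* D) ℕ.+ w ℕ.* D ℕ.* (w ℕ.* D) ≡ (n ℕ.+ w ℕ.* w) ℕ.* (D ℕ.* D)
  regroup = ℕ-Solver.solve-∀
  instance _ = ℕ.m*n≢0 D D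

module FullTwoTorsionCurve (A B : ℚ) where

  open Weierstrass (- (A + B)) (A * B) 0ℚ public

  cubic-factorisation : ∀ x → cubic x ≡ x * (x - A) * (x - B)
  cubic-factorisation = factorisation A B
    where factorisation : ∀ A B x → x * x * x + (- (A + B)) * x * x + (A * B) * x + 0ℚ ≡ x * (x - A) * (x - B)
          factorisation = solve-∀ ℚ-ring

  roots : ∀ x → cubic x ≡ 0ℚ → x ≡ 0ℚ ⊎ x ≡ A ⊎ x ≡ B
  roots x cubic≡0 =
    [ Sum.map₂ (inj₁ ∘ p-q≡0⇒p≡q) ∘ p*q≡0⇒p≡0∨q≡0 x (x - A) , inj₂ ∘ inj₂ ∘ p-q≡0⇒p≡q ]′
      (p*q≡0⇒p≡0∨q≡0 (x * (x - A)) (x - B) (trans (sym (cubic-factorisation x)) cubic≡0))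

  nonsingular : A ≢ 0ℚ → B ≢ 0ℚ → A ≢ B → NonSingular
  nonsingular A≢0 B≢0 A≢B x cubic≡0 = simple (roots x cubic≡0)
    where
    simple : ∀ {x} → x ≡ 0ℚ ⊎ x ≡ A ⊎ x ≡ B → cubic′ x ≢ 0ℚ
    simple (inj₁ refl)        = p*q≢0 A≢0 B≢0 ∘ trans (sym (at-0 A B))
      where at-0 : ∀ A B → (1ℚ + 1ℚ + 1ℚ) * 0ℚ * 0ℚ + (1ℚ + 1ℚ) * (- (A + B)) * 0ℚ + A * B ≡ A * B
            at-0 = solve-∀ ℚ-ring
    simple (inj₂ (inj₁ refl)) = p*q≢0 A≢0 (p≢q⇒p-q≢0 A≢B) ∘ trans (sym (at-A A B))
      where at-A : ∀ A B → (1ℚ + 1ℚ + 1ℚ) * A * A + (1ℚ + 1ℚ) * (- (A + B)) * A + A * B ≡ A * (A - B)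
            at-A = solve-∀ ℚ-ring
    simple (inj₂ (inj₂ refl)) = p*q≢0 B≢0 (p≢q⇒p-q≢0 (A≢B ∘ sym)) ∘ trans (sym (at-B A B))
      where at-B : ∀ A B → (1ℚ + 1ℚ + 1ℚ) * B * B + (1ℚ + 1ℚ) * (- (A + B)) * B + A * B ≡ B * (B - A)
            at-B = solve-∀ ℚ-ring

  A-root : cubic A ≡ 0ℚ
  A-root = trans (cubic-factorisation A) (vanish A B)
    where vanish : ∀ A B → A * (A - A) * (A - B) ≡ 0ℚ
          vanish = solve-∀ ℚ-ring

  B-root : cubic B ≡ 0ℚ
  B-root = trans (cubic-factorisation B) (vanish A B)
    where vanish : ∀ A B → B * (B - A) * (B - B) ≡ 0ℚ
          vanish = solve-∀ ℚ-ring

gcd≡1⇒coprime-legs : ∀ {a b c} → gcd (gcd a b) c ≡ 1 → a ℕ.* a ℕ.+ b ℕ.* b ≡ c ℕ.* c → Coprime a b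
gcd≡1⇒coprime-legs g≡1 pythagorean {d} (d∣a , d∣b) =
  ∣1⇒≡1 (subst (d ∣_) g≡1 (gcd-greatest (gcd-greatest d∣a d∣b) (∣-legs⇒∣-hypotenuse d∣a d∣b pythagorean)))

coprime-legs-distinct : ∀ {a b c} → Coprime a b → a ℕ.* a ℕ.+ b ℕ.* b ≡ c ℕ.* c → a ≢ b
coprime-legs-distinct {a} {c = c} a⊥a pythagorean refl =
  two-not-square c (trans (cong (λ n → n ℕ.* n ℕ.+ n ℕ.* n) (sym (a⊥a (∣-refl , ∣-refl)))) pythagorean)
  where
  two-not-square : ∀ c → 2 ≢ c ℕ.* c
  two-not-square 0 ()
  two-not-square 1 ()
  two-not-square 2 ()
  two-not-square (suc (suc (suc _))) ()

negative-not-square : ∀ {a} → 0 < a → ¬ IsSquare (0ℚ - ⟦ a ℕ.* a ⟧)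
negative-not-square {a} a>0 (s , -aa≡ss) with integral-square-difference 0 (a ℕ.* a) s -aa≡ss
... | w , 0≡aa+ww = ℕ.<⇒≢ a>0 (sym (n*n≡0⇒n≡0 (ℕ.m+n≡0⇒m≡0 (a ℕ.* a) (sym 0≡aa+ww))))

no-rational-square-difference : ∀ {a b c} → 0 < b → Coprime a b → a ℕ.* a ℕ.+ b ℕ.* b ≡ c ℕ.* c →
  ¬ IsSquare (⟦ a ℕ.* a ⟧ - ⟦ b ℕ.* b ⟧)
no-rational-square-difference {a} {b} {c} b>0 a⊥b pythagorean (s , difference≡ss)
  with integral-square-difference (a ℕ.* a) (b ℕ.* b) s difference≡ss
... | w , aa≡bb+ww = no-square-sum-and-difference a record
  { y = b ; z = c ; w = w ; coprime = a⊥b ; y>0 = b>0 ; difference = aa≡bb+ww ; sum = sym pythagorean }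

module PrimitiveTripleCurve {a b c : ℕ} (triple : PrimitivePythagoreanTriple a b c) where

  A B : ℚ
  A = ⟦ a ℕ.* a ⟧
  B = ⟦ b ℕ.* b ⟧

  open FullTwoTorsionCurve A B public

  private
    a>0 = proj₁ triple
    b>0 = proj₁ (proj₂ triple)
    pythagorean = proj₂ (proj₂ (proj₂ (proj₂ triple)))
    a⊥b : Coprime a b
    a⊥b = gcd≡1⇒coprime-legs {c = c} (proj₁ (proj₂ (proj₂ (proj₂ triple)))) pythagorean
    A≢0 : A ≢ 0ℚ
    A≢0 = ℕ.<⇒≢ a>0 ∘ sym ∘ n*n≡0⇒n≡0 ∘ ⟦⟧-injective
    A≢B : A ≢ B
    A≢B = coprime-legs-distinct {c = c} a⊥b pythagorean ∘ m*m≡n*n⇒m≡n ∘ ⟦⟧-injective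

  nonsingular-legs : NonSingular
  nonsingular-legs = nonsingular A≢0 (ℕ.<⇒≢ b>0 ∘ sym ∘ n*n≡0⇒n≡0 ∘ ⟦⟧-injective) A≢B

  no-root-with-square-differences : ∀ x → cubic x ≡ 0ℚ → ¬ (∀ e → cubic e ≡ 0ℚ → x ≢ e → IsSquare (x - e))
  no-root-with-square-differences x root squares = excluded (roots x root)
    where
    excluded : x ≡ 0ℚ ⊎ x ≡ A ⊎ x ≡ B → ⊥
    excluded (inj₁ x≡0) =
      negative-not-square a>0 (subst (λ x → IsSquare (x - A)) x≡0 (squares A A-root (A≢0 ∘ sym ∘ trans (sym x≡0))))
    excluded (inj₂ (inj₁ x≡A)) =
      no-rational-square-difference {c = c} b>0 a⊥b pythagorean
        (subst (λ x → IsSquare (x - B)) x≡A (squares B B-root (A≢B ∘ trans (sym x≡A))))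
    excluded (inj₂ (inj₂ x≡B)) =
      no-rational-square-difference {c = c} a>0 (Coprime-sym a⊥b) (trans (ℕ.+-comm (b ℕ.* b) (a ℕ.* a)) pythagorean)
        (subst (λ x → IsSquare (x - A)) x≡B (squares A A-root (A≢B ∘ sym ∘ trans (sym x≡B))))

corollary5p1 : (a b c : ℕ) → PrimitivePythagoreanTriple a b c →
    ¬ (Σ Point (λ P → OnCurve E[ a , b ] P × HasOrder E[ a , b ] P 8))
corollary5p1 a b c triple (P , on , order-8) = no-root-with-square-differences x₄ root squares
  where
  open PrimitiveTripleCurve triple
  x₄-facts = order-8⇒descent-squares nonsingular-legs P on order-8
  x₄ = proj₁ x₄-facts
  root = proj₁ (proj₂ x₄-facts)
  squares = proj₂ (proj₂ x₄-facts)
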